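{- For every $n\ge1$, the map $\pi\mapsto\Psi(\psi(\pi))$ is a bijection from the set $\mathcal{S}_n$ of snakes of length $n$ onto the set $\mathcal{P}_n$ of labeled ballot paths of length $n$.
   Context: A snake of length $n$ is a word $p_1\cdots p_n$ with $p_i=\pm\rho_i$ for some permutation $\rho$ of $[n]$, such that $p_1>0$ and $p_1>p_2<p_3>p_4<\cdots$. A ballot path of $n$ steps is a word $P=p_1\cdots p_n$ over $\{U,D\}$ (steps $(1,1)$, $(1,-1)$ from $(0,0)$) never going below the $x$-axis; its height $h_i(P)$ is the number of $U$'s minus the number of $D$'s among $p_1,\dots,p_{i-1}$. A labeled ballot path of length $n$ is a pair $(P,w)$ with $P$ a ballot path of $n$ steps and $w\in\mathbb{N}^n$ with $0\le w_i\le h_i(P)$ if $p_i=U$ and $0\le w_i\le h_i(P)-1$ if $p_i=D$; $\mathcal{P}_n$ is the set of these. The map $\psi$: given a snake $\pi$ of length $n$, let $\tilde\pi_i=n+\pi_i$ if $\pi_i>0$ and $\tilde\pi_i=n+1+\pi_i$ if $\pi_i<0$; then $\psi(\pi)$ is the unique permutation $\sigma$ of $[2n]$ with $\sigma_i+\sigma_{2n+1-i}=2n+1$ for all $i$ whose first half $\sigma_1\cdots\sigma_n$ equals $\tilde\pi_n\cdots\tilde\pi_1$ if $n$ is odd, and whose second half $\sigma_{n+1}\cdots\sigma_{2n}$ equals $\tilde\pi_1\cdots\tilde\pi_n$ if $n$ is even. The Foata–Zeilberger map on permutations $\sigma$ of $[N]$: with $\sigma_0=0$, $\sigma_{N+1}=+\infty$,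 $\Psi_{FZ}(\sigma)=(m_1\cdots m_N,w_1\cdots w_N)$ where for $i$ with $\sigma_j=i$: $m_i=U$ if $\sigma_{j-1}>\sigma_j<\sigma_{j+1}$, $m_i=D$ if $\sigma_{j-1}<\sigma_j>\sigma_{j+1}$, $m_i=H$ if $\sigma_{j-1}<\sigma_j<\sigma_{j+1}$, $m_i=\tilde H$ if $\sigma_{j-1}>\sigma_j>\sigma_{j+1}$, and $w_i=|\{k:k<j,\ \sigma_k<\sigma_j=i<\sigma_{k-1}\}|$. For a permutation $\sigma$ of $[2n]$ in the image of $\psi$, $\Psi(\sigma)$ is the pair $(m_1\cdots m_n,w_1\cdots w_n)$ consisting of the first halves of $\Psi_{FZ}(\sigma)=(m_1\cdots m_{2n},w_1\cdots w_{2n})$. -}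

module Defs where

open import Data.Nat using (ℕ; zero; suc; _+_; _∸_; _*_; _≤_; _<_; _<ᵇ_; _≡ᵇ_)
open import Data.Integer using (ℤ; +_; -[1+_]; ∣_∣) renaming (_<_ to _<ℤ_; _>_ to _>ℤ_)
open import Data.List using (List; []; _∷_; _++_; map; reverse; length; upTo)
open import Data.List.Relation.Binary.Permutation.Propositional using (_↭_)
open import Data.Bool using (Bool; true; false; if_then_else_; _∧_)
open import Data.Maybe using (Maybe; just; nothing)
open import Data.Product using (_×_; _,_)
open import Data.Unit using (⊤)
open import Data.Empty using (⊥)
open import Data.Nat using (_%_)
open import Relation.Binary.PropositionalEquality using (_≡_)

mutual
  AltDown : List ℤ → Set
  AltDown (x ∷ y ∷ r) = (x >ℤ y) × AltUp (y ∷ r)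
  AltDown _ = ⊤

  AltUp : List ℤ → Set
  AltUp (x ∷ y ∷ r) = (x <ℤ y) × AltDown (y ∷ r)
  AltUp _ = ⊤

FirstPos : List ℤ → Set
FirstPos [] = ⊤
FirstPos (x ∷ _) = (+ 0) <ℤ x

oneTo : ℕ → List ℕ
oneTo n = map suc (upTo n)

IsSnake : ℕ → List ℤ → Set
IsSnake n p = (length p ≡ n) × (map ∣_∣ p ↭ oneTo n) × FirstPos p × AltDown p

data Step : Set where
  U D H H̃ : Step

-- LB h P w : (P , w) is a labeled ballot path starting at height h
-- (U: 0 ≤ w ≤ h; D: 0 ≤ w ≤ h - 1, which also forces h ≥ 1, i.e. the
-- path does not go below the x-axis; only U and D steps allowed).
LB : ℕ → List Step → List ℕ → Set
LB h [] [] = ⊤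
LB h (U ∷ P) (x ∷ w) = (x ≤ h) × LB (suc h) P w
LB h (D ∷ P) (x ∷ w) = (x < h) × LB (h ∸ 1) P w
LB h _ _ = ⊥

IsLBP : ℕ → List Step × List ℕ → Set
IsLBP n (P , w) = (length P ≡ n) × LB 0 P w

-- π̃ᵢ = n + πᵢ if πᵢ > 0 and n + 1 + πᵢ if πᵢ < 0
-- (+ k ↦ n + k ;  -[1+ k ] = -(k+1) ↦ n + 1 - (k + 1) = n - k)
tilde : ℕ → ℤ → ℕ
tilde n (+ k) = n + k
tilde n -[1+ k ] = n ∸ k

odd : ℕ → Bool
odd n = (n % 2) ≡ᵇ 1

-- ψ(π) as the word σ₁ ⋯ σ₂ₙ, where σᵢ + σ_{2n+1-i} = 2n+1.
psi : ℕ → List ℤ → List ℕ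
psi n π =
  let t  = map (tilde n) π
      c  = map (λ v → (suc (2 * n)) ∸ v)
  in if odd n
     then reverse t ++ c t
     else reverse (c t) ++ t

findSplit : ℕ → List ℕ → Maybe (List ℕ × List ℕ)
findSplit i [] = nothing
findSplit i (x ∷ xs) with x ≡ᵇ i
... | true = just ([] , xs)
... | false with findSplit i xs
...   | nothing = nothing
...   | just (L , R) = just (x ∷ L , R)

lastOr : ℕ → List ℕ → ℕ
lastOr d [] = d
lastOr d (x ∷ xs) = lastOr x xs

-- i < σ_{j+1}, with σ_{N+1} = +∞
ltNext : ℕ → List ℕ → Bool
ltNext i [] = true
ltNext i (b ∷ _) = i <ᵇ b

classify : Bool → Bool → Step   -- (σ_{j-1} > i) , (i < σ_{j+1})
classify true  true  = U
classify false false = D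
classify false true  = H
classify true  false = H̃

countPairs : ℕ → List ℕ → ℕ
countPairs i (a ∷ b ∷ r) = (if (b <ᵇ i) ∧ (i <ᵇ a) then 1 else 0) + countPairs i (b ∷ r)
countPairs i _ = 0

-- (mᵢ , wᵢ) of Ψ_FZ(σ) for the value i; σ₀ = 0.
-- (The `nothing` branch never occurs for permutations containing i.)
fzAt : List ℕ → ℕ → Step × ℕ
fzAt σ i with findSplit i σ
... | nothing = (H , 0)
... | just (L , R) =
  (classify (i <ᵇ lastOr 0 L) (ltNext i R) , countPairs i (0 ∷ L))

PsiFZhalf : ℕ → List ℕ → List Step × List ℕ
PsiFZhalf n σ = (map (λ i → Data.Product.proj₁ (fzAt σ i)) (oneTo n) ,
                 map (λ i → Data.Product.proj₂ (fzAt σ i)) (oneTo n))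

Φ : ℕ → List ℤ → List Step × List ℕ
Φ n π = PsiFZhalf n (psi n π)

{-# OPTIONS --safe #-}
-- For a threshold i, cut the framed word 0 ∷ σ ++ [ 2n + 1 ] into maximal
-- runs of letters below i and at or above i. The FZ step of the letter i
-- records whether its neighbours are low or high, and its label counts the
-- segments before it; so raising the threshold from i to i + 1 changes the
-- low runs by an insertion determined by (mᵢ, wᵢ) alone, possible exactly
-- while the path stays weakly above the axis (there is one more low run than
-- the height). Sweeping i = 1, …, n thus builds the low runs at threshold
-- n + 1 from Ψ(ψ(π)). As ψ(π) is its own reverse complement, its high runs
-- there are the mirrored complements of its low runs, so Ψ(ψ(π)) determines
-- ψ(π) and hence π. For a snake every inner letter of the framed word is a
-- local extremum, so all steps are U or D. Conversely, a labeled ballot path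
-- builds low runs whose symmetric completion is a framed word; sweeping it
-- returns the path, its U/D steps make the word alternate, and alternation
-- is exactly the snake condition on the π that the word encodes.
module Submission where

open import Defs
open import Data.Bool using (Bool; true; false; not; T; _∧_; if_then_else_)
open import Data.Bool.Properties using (not-involutive)
open import Data.Empty using (⊥; ⊥-elim)
open import Data.Integer using (ℤ; -[1+_]; ∣_∣; +<+; -<+; -<-) renaming (+_ to +ℤ_; _<_ to _<ℤ_)
open import Data.List using (List; []; _∷_; _++_; _∷ʳ_; [_]; map; reverse; length; concat; zip; take; drop; applyUpTo; upTo)
open import Data.List.Properties
  using ( ++-assoc; ++-identityʳ; ∷-injective; ∷-injectiveˡ; ∷-injectiveʳ; ∷ʳ-injectiveˡ
        ; length-++; length-map; length-reverse; map-++; map-∘; map-id-local; reverse-++; reverse-map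
        ; reverse-involutive; unfold-reverse; map-applyUpTo; length-upTo
        ; take++drop≡id; length-take; length-drop)
open import Data.List.Relation.Unary.All as All using (All; []; _∷_)
open import Data.List.Relation.Unary.All.Properties using (++⁺; ++⁻ˡ; ++⁻ʳ; map⁺; map⁻)
open import Data.List.Relation.Binary.Permutation.Propositional as ↭
  using (_↭_; prep; ↭-refl; ↭-reflexive; ↭-sym; ↭-trans)
open import Data.List.Relation.Binary.Permutation.Propositional.Properties
  using (shift; shifts; ∷↭∷ʳ; ++⁺ˡ; ↭-length; ↭-reverse; All-resp-↭)
open import Data.Maybe using (just; nothing)
open import Data.Nat
  using (ℕ; zero; suc; _+_; _∸_; _*_; _≤_; _<_; _<ᵇ_; _≡ᵇ_; _%_; _/_; z≤n; s≤s; _≟_; _<?_; _≤?_)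
open import Data.Nat.Properties
open import Algebra.Properties.CommutativeSemigroup +-commutativeSemigroup using () renaming (interchange to +-interchange)
open import Data.Nat.DivMod using (m≡m%n+[m/n]*n; m%n<n)
open import Data.Product using (Σ; ∃; _×_; _,_; proj₁; proj₂)
open import Data.Sum using (_⊎_; inj₁; inj₂)
open import Data.Unit using (⊤; tt)
open import Function using (_∘_)
open import Relation.Nullary using (¬_; yes; no)
open import Relation.Binary.PropositionalEquality hiding ([_])

<ᵇ-true : ∀ {m n} → m < n → (m <ᵇ n) ≡ true
<ᵇ-true {zero} {suc n} _ = refl
<ᵇ-true {suc m} {suc n} (s≤s p) = <ᵇ-true p

<ᵇ-false : ∀ {m n} → n ≤ m → (m <ᵇ n) ≡ false
<ᵇ-false {m} {zero} _ = refl
<ᵇ-false {suc m} {suc n} (s≤s p) = <ᵇ-false p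

<ᵇ-true⇒< : ∀ {m n} → (m <ᵇ n) ≡ true → m < n
<ᵇ-true⇒< {m} {n} e = <ᵇ⇒< m n (subst T (sym e) tt)

<ᵇ-false⇒≥ : ∀ {m n} → (m <ᵇ n) ≡ false → n ≤ m
<ᵇ-false⇒≥ e = ≮⇒≥ λ p → subst T e (<⇒<ᵇ p)

≡ᵇ-refl : ∀ m → (m ≡ᵇ m) ≡ true
≡ᵇ-refl zero = refl
≡ᵇ-refl (suc m) = ≡ᵇ-refl m

≡ᵇ-false : ∀ {m n} → m ≢ n → (m ≡ᵇ n) ≡ false
≡ᵇ-false {zero} {zero} p = ⊥-elim (p refl)
≡ᵇ-false {zero} {suc n} p = refl
≡ᵇ-false {suc m} {zero} p = refl
≡ᵇ-false {suc m} {suc n} p = ≡ᵇ-false (p ∘ cong suc)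

≡ᵇ-cong : ∀ {a b c d} → (a ≡ b → c ≡ d) → (c ≡ d → a ≡ b) → (a ≡ᵇ b) ≡ (c ≡ᵇ d)
≡ᵇ-cong {a} {b} {c} {d} f g with a ≟ b | c ≟ d
... | yes refl | yes refl = trans (≡ᵇ-refl a) (sym (≡ᵇ-refl c))
... | yes p | no q = ⊥-elim (q (f p))
... | no p | yes q = ⊥-elim (p (g q))
... | no p | no q = trans (≡ᵇ-false p) (sym (≡ᵇ-false q))

indicator : Bool → ℕ
indicator b = if b then 1 else 0

indicator-∧-falseˡ : ∀ {a} b → a ≡ false → indicator (a ∧ b) ≡ 0
indicator-∧-falseˡ b refl = refl

indicator-∧-falseʳ : ∀ a {b} → b ≡ false → indicator (a ∧ b) ≡ 0
indicator-∧-falseʳ false refl = refl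
indicator-∧-falseʳ true refl = refl

NonEmpty : {A : Set} → List A → Set
NonEmpty [] = ⊥
NonEmpty (_ ∷ _) = ⊤

nonEmpty? : List ℕ → Bool
nonEmpty? [] = false
nonEmpty? (_ ∷ _) = true

NonEmpty-++ʳ : ∀ {A : Set} (xs : List A) {ys} → NonEmpty ys → NonEmpty (xs ++ ys)
NonEmpty-++ʳ [] ne = ne
NonEmpty-++ʳ (_ ∷ _) _ = tt

NonEmpty-++ˡ : ∀ {A : Set} {xs : List A} ys → NonEmpty xs → NonEmpty (xs ++ ys)
NonEmpty-++ˡ {xs = _ ∷ _} _ _ = tt

++≡++∷-cases : ∀ (A Z P Q : List ℕ) x → A ++ Z ≡ P ++ x ∷ Q →
  (Σ (List ℕ) λ A₂ → (A ≡ P ++ x ∷ A₂) × (Q ≡ A₂ ++ Z)) ⊎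
  (Σ (List ℕ) λ P₂ → (P ≡ A ++ P₂) × (Z ≡ P₂ ++ x ∷ Q))
++≡++∷-cases [] Z P Q x eq = inj₂ (P , refl , eq)
++≡++∷-cases (a ∷ A) Z [] Q x eq with ∷-injective eq
... | refl , e = inj₁ (A , refl , sym e)
++≡++∷-cases (a ∷ A) Z (p ∷ P) Q x eq with ∷-injective eq
... | refl , e with ++≡++∷-cases A Z P Q x e
...   | inj₁ (A₂ , e₁ , e₂) = inj₁ (A₂ , cong (a ∷_) e₁ , e₂)
...   | inj₂ (P₂ , e₁ , e₂) = inj₂ (P₂ , cong (a ∷_) e₁ , e₂)

lastOr-++ : ∀ d A y Y → lastOr d (A ++ y ∷ Y) ≡ lastOr y Y
lastOr-++ d [] y Y = refl
lastOr-++ d (a ∷ A) y Y = lastOr-++ a A y Y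

lastOr-∷≡ : ∀ d L F b B → d ∷ L ≡ F ++ b ∷ B → lastOr d L ≡ lastOr b B
lastOr-∷≡ d L [] b B eq with ∷-injective eq
... | refl , refl = refl
lastOr-∷≡ d L (f ∷ F) b B eq with ∷-injective eq
... | refl , refl = lastOr-++ d F b B

lastOr-All : ∀ {P : ℕ → Set} x X → All P (x ∷ X) → P (lastOr x X)
lastOr-All x [] (px ∷ _) = px
lastOr-All x (y ∷ X) (_ ∷ ps) = lastOr-All y X ps

∷-lastOr : ∀ d L → Σ (List ℕ) λ A → d ∷ L ≡ A ∷ʳ lastOr d L
∷-lastOr d [] = [] , refl
∷-lastOr d (x ∷ L) with ∷-lastOr x L
... | A , e = d ∷ A , cong (d ∷_) e

-- Segmentations of a word at a threshold

-- Framed as 0 ∷ σ ++ [ 2n + 1 ], a word starts low and ends high at every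
-- threshold 1 ≤ i ≤ 2n + 1, so it is cut into such segments.

Seg : Set
Seg = List ℕ × List ℕ

LowHigh : ℕ → Seg → Set
LowHigh i (B , R) = NonEmpty B × All (_< i) B × NonEmpty R × All (i ≤_) R

Segmentation : ℕ → List Seg → Set
Segmentation i = All (LowHigh i)

unsegment : List Seg → List ℕ
unsegment [] = []
unsegment ((B , R) ∷ Ds) = B ++ R ++ unsegment Ds

lows : List Seg → List (List ℕ)
lows = map proj₁

unsegment-++ : ∀ Ds Es → unsegment (Ds ++ Es) ≡ unsegment Ds ++ unsegment Es
unsegment-++ [] Es = refl
unsegment-++ ((B , R) ∷ Ds) Es = begin
  B ++ R ++ unsegment (Ds ++ Es)        ≡⟨ cong (λ z → B ++ R ++ z) (unsegment-++ Ds Es) ⟩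
  B ++ R ++ unsegment Ds ++ unsegment Es ≡⟨ cong (B ++_) (++-assoc R _ _) ⟨
  B ++ (R ++ unsegment Ds) ++ unsegment Es ≡⟨ ++-assoc B _ _ ⟨
  (B ++ R ++ unsegment Ds) ++ unsegment Es ∎
  where open ≡-Reasoning

consLow : ℕ → List Seg → List Seg
consLow x [] = ([ x ] , []) ∷ []
consLow x ((B , R) ∷ Ds) = (x ∷ B , R) ∷ Ds

consHigh : ℕ → List Seg → List Seg
consHigh x [] = ([] , [ x ]) ∷ []
consHigh x (([] , R) ∷ Ds) = ([] , x ∷ R) ∷ Ds
consHigh x ((b ∷ B , R) ∷ Ds) = ([] , [ x ]) ∷ (b ∷ B , R) ∷ Ds

segment : ℕ → List ℕ → List Seg
segment i [] = []
segment i (x ∷ xs) with x <? i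
... | yes _ = consLow x (segment i xs)
... | no _ = consHigh x (segment i xs)

segment-low : ∀ {i x} xs → x < i → segment i (x ∷ xs) ≡ consLow x (segment i xs)
segment-low {i} {x} xs p with x <? i
... | yes _ = refl
... | no q = ⊥-elim (q p)

segment-high : ∀ {i x} xs → i ≤ x → segment i (x ∷ xs) ≡ consHigh x (segment i xs)
segment-high {i} {x} xs p with x <? i
... | yes q = ⊥-elim (<⇒≱ q p)
... | no _ = refl

StartsLow : List Seg → Set
StartsLow [] = ⊤
StartsLow ((B , _) ∷ _) = NonEmpty B

segment-highRun : ∀ {i} r R W → All (i ≤_) (r ∷ R) → StartsLow (segment i W) →
  segment i (r ∷ R ++ W) ≡ ([] , r ∷ R) ∷ segment i W
segment-highRun {i} r [] W (p ∷ _) h rewrite segment-high W p with segment i W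
... | [] = refl
... | (_ ∷ _ , _) ∷ _ = refl
segment-highRun {i} r (r′ ∷ R) W (p ∷ ps) h
  rewrite segment-high (r′ ∷ R ++ W) p | segment-highRun r′ R W ps h = refl

segment-lowRun : ∀ {i} b B Y R Ds → All (_< i) (b ∷ B) → segment i Y ≡ ([] , R) ∷ Ds →
  segment i (b ∷ B ++ Y) ≡ (b ∷ B , R) ∷ Ds
segment-lowRun {i} b [] Y R Ds (p ∷ _) e rewrite segment-low Y p | e = refl
segment-lowRun {i} b (b′ ∷ B) Y R Ds (p ∷ ps) e
  rewrite segment-low (b′ ∷ B ++ Y) p | segment-lowRun b′ B Y R Ds ps e = refl

segment-unsegment : ∀ {i} Ds → Segmentation i Ds → segment i (unsegment Ds) ≡ Ds
segment-unsegment [] [] = refl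
segment-unsegment {i} ((b ∷ B , r ∷ R) ∷ Ds) ((_ , lo , _ , hi) ∷ v) =
  segment-lowRun b B (r ∷ R ++ unsegment Ds) (r ∷ R) Ds lo
    (trans (segment-highRun r R (unsegment Ds) hi (subst StartsLow (sym ih) (startsLow Ds v)))
           (cong (([] , r ∷ R) ∷_) ih))
  where
  ih = segment-unsegment Ds v
  startsLow : ∀ Es → Segmentation i Es → StartsLow Es
  startsLow [] _ = tt
  startsLow (_ ∷ _) ((ne , _) ∷ _) = ne

segmentation-unique : ∀ {i} Ds Es → Segmentation i Ds → Segmentation i Es →
  unsegment Ds ≡ unsegment Es → Ds ≡ Es
segmentation-unique {i} Ds Es vD vE e = begin
  Ds                      ≡⟨ segment-unsegment Ds vD ⟨
  segment i (unsegment Ds) ≡⟨ cong (segment i) e ⟩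
  segment i (unsegment Es) ≡⟨ segment-unsegment Es vE ⟩
  Es                      ∎
  where open ≡-Reasoning

record Location (i : ℕ) (Ds : List Seg) (P Q : List ℕ) : Set where
  constructor location
  field
    before : List Seg
    B X Y : List ℕ
    after : List Seg
    segs≡ : Ds ≡ before ++ (B , X ++ i ∷ Y) ∷ after
    left≡ : P ≡ unsegment before ++ B ++ X
    right≡ : Q ≡ Y ++ unsegment after

locate : ∀ {i} Ds P Q → Segmentation i Ds → unsegment Ds ≡ P ++ i ∷ Q → Location i Ds P Q
locate [] [] Q v ()
locate [] (_ ∷ _) Q v ()
locate {i} ((B , R) ∷ Ds) P Q ((_ , lo , _) ∷ v) eq with ++≡++∷-cases B (R ++ unsegment Ds) P Q i eq
... | inj₁ (_ , e₁ , _) = ⊥-elim (<-irrefl refl (All.head (++⁻ʳ P (subst (All (_< i)) e₁ lo))))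
... | inj₂ (P₂ , e₁ , e₂) with ++≡++∷-cases R (unsegment Ds) P₂ Q i e₂
...   | inj₁ (Y , f₁ , f₂) = location [] B P₂ Y Ds (cong (λ z → (B , z) ∷ Ds) f₁) e₁ f₂
...   | inj₂ (P₃ , f₁ , f₂) with locate Ds P₃ Q v f₂
...     | location before B′ X Y after eD eP eQ =
          location ((B , R) ∷ before) B′ X Y after (cong ((B , R) ∷_) eD) left eQ
  where
  open ≡-Reasoning
  left : P ≡ (B ++ R ++ unsegment before) ++ B′ ++ X
  left = begin
    P                                        ≡⟨ e₁ ⟩
    B ++ P₂                                  ≡⟨ cong (B ++_) (trans f₁ (cong (R ++_) eP)) ⟩
    B ++ R ++ unsegment before ++ B′ ++ X    ≡⟨ cong (B ++_) (++-assoc R _ _) ⟨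
    B ++ (R ++ unsegment before) ++ B′ ++ X  ≡⟨ ++-assoc B _ _ ⟨
    (B ++ R ++ unsegment before) ++ B′ ++ X  ∎

strictify : ∀ {i} xs → All (i ≤_) xs → All (_≢ i) xs → All (i <_) xs
strictify [] [] [] = []
strictify (x ∷ xs) (p ∷ ps) (q ∷ qs) = ≤∧≢⇒< p (q ∘ sym) ∷ strictify xs ps qs

raise-segmentation : ∀ {i} Ds → Segmentation i Ds → All (_≢ i) (unsegment Ds) → Segmentation (suc i) Ds
raise-segmentation [] [] _ = []
raise-segmentation ((B , R) ∷ Ds) ((neB , lo , neR , hi) ∷ v) i∉ =
  (neB , All.map m<n⇒m<1+n lo , neR , strictify R hi (++⁻ˡ R (++⁻ʳ B i∉)))
  ∷ raise-segmentation Ds v (++⁻ʳ R (++⁻ʳ B i∉))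

findSplit-first : ∀ i L R → All (_≢ i) L → findSplit i (L ++ i ∷ R) ≡ just (L , R)
findSplit-first i [] R _ rewrite ≡ᵇ-refl i = refl
findSplit-first i (x ∷ L) R (p ∷ ps) rewrite ≡ᵇ-false p | findSplit-first i L R ps = refl

fzAt-split : ∀ i L R → All (_≢ i) L →
  fzAt (L ++ i ∷ R) i ≡ (classify (i <ᵇ lastOr 0 L) (ltNext i R) , countPairs i (0 ∷ L))
fzAt-split i L R p rewrite findSplit-first i L R p = refl

countPairs-++∷ : ∀ i xs y ys → countPairs i (xs ++ y ∷ ys) ≡ countPairs i (xs ++ [ y ]) + countPairs i (y ∷ ys)
countPairs-++∷ i [] y ys = refl
countPairs-++∷ i (a ∷ []) y ys = cong (_+ countPairs i (y ∷ ys)) (sym (+-identityʳ _))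
countPairs-++∷ i (a ∷ a′ ∷ xs) y ys =
  trans (cong (_+_ (indicator ((a′ <ᵇ i) ∧ (i <ᵇ a)))) (countPairs-++∷ i (a′ ∷ xs) y ys))
        (sym (+-assoc (indicator ((a′ <ᵇ i) ∧ (i <ᵇ a))) _ _))

countPairs-high : ∀ {i} xs → All (i ≤_) xs → countPairs i xs ≡ 0
countPairs-high [] _ = refl
countPairs-high (x ∷ []) _ = refl
countPairs-high {i} (x ∷ x′ ∷ xs) (_ ∷ p ∷ ps) =
  cong₂ _+_ (indicator-∧-falseˡ _ (<ᵇ-false p)) (countPairs-high (x′ ∷ xs) (p ∷ ps))

countPairs-lowHigh : ∀ {i} b B X → All (_< i) (b ∷ B) → All (i ≤_) X → countPairs i (b ∷ B ++ X) ≡ 0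
countPairs-lowHigh b [] [] _ _ = refl
countPairs-lowHigh b [] (x ∷ X) _ (p ∷ ps) =
  cong₂ _+_ (indicator-∧-falseˡ _ (<ᵇ-false p)) (countPairs-high (x ∷ X) (p ∷ ps))
countPairs-lowHigh b (b′ ∷ B) X (p ∷ p′ ∷ ps) qs =
  cong₂ _+_ (indicator-∧-falseʳ _ (<ᵇ-false (<⇒≤ p))) (countPairs-lowHigh b′ B X (p′ ∷ ps) qs)

countPairs-descent : ∀ {i} r R w → All (i <_) (r ∷ R) → w < i → countPairs i (r ∷ R ++ [ w ]) ≡ 1
countPairs-descent r [] w (p ∷ _) q rewrite <ᵇ-true q | <ᵇ-true p = refl
countPairs-descent r (r′ ∷ R) w (p ∷ p′ ∷ ps) q =
  cong₂ _+_ (indicator-∧-falseˡ _ (<ᵇ-false (<⇒≤ p′))) (countPairs-descent r′ R w (p′ ∷ ps) q)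

countPairs-segment : ∀ {i} b B r R w → All (_< i) (b ∷ B) → All (i <_) (r ∷ R) → w < i →
  countPairs i (b ∷ B ++ r ∷ R ++ [ w ]) ≡ 1
countPairs-segment b [] r R w _ (p ∷ ps) q =
  cong₂ _+_ (indicator-∧-falseˡ _ (<ᵇ-false (<⇒≤ p))) (countPairs-descent r R w (p ∷ ps) q)
countPairs-segment b (b′ ∷ B) r R w (p ∷ p′ ∷ ps) qs q =
  cong₂ _+_ (indicator-∧-falseʳ _ (<ᵇ-false (<⇒≤ p))) (countPairs-segment b′ B r R w (p′ ∷ ps) qs q)

unsegment-startsLow : ∀ {i} pre z Z → Segmentation i pre → z < i →
  Σ ℕ λ w → Σ (List ℕ) λ W → (unsegment pre ++ z ∷ Z ≡ w ∷ W) × w < i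
unsegment-startsLow [] z Z _ q = z , Z , refl , q
unsegment-startsLow ((b ∷ B , R) ∷ pre) z Z ((_ , p ∷ _ , _) ∷ _) q = b , _ , refl , p

-- Each segment before i contributes exactly one descent across i: from its high run into the next low run.
countPairs-segments : ∀ {i} pre z Z → Segmentation i pre → Segmentation (suc i) pre → z < i →
  countPairs i (unsegment pre ++ z ∷ Z) ≡ length pre + countPairs i (z ∷ Z)
countPairs-segments [] z Z _ _ _ = refl
countPairs-segments {i} ((b ∷ B , r ∷ R) ∷ pre) z Z ((_ , lo , _) ∷ v) ((_ , _ , _ , hi) ∷ v′) z<i
  with unsegment-startsLow pre z Z v z<i
... | w , W , e , w<i = begin
  countPairs i ((b ∷ B ++ r ∷ R ++ unsegment pre) ++ z ∷ Z)
    ≡⟨ cong (countPairs i) (++-assoc (b ∷ B) (r ∷ R ++ unsegment pre) (z ∷ Z)) ⟩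
  countPairs i (b ∷ B ++ (r ∷ R ++ unsegment pre) ++ z ∷ Z)
    ≡⟨ cong (λ u → countPairs i (b ∷ B ++ u)) (++-assoc (r ∷ R) (unsegment pre) (z ∷ Z)) ⟩
  countPairs i (b ∷ B ++ r ∷ R ++ unsegment pre ++ z ∷ Z)
    ≡⟨ cong (countPairs i) (++-assoc (b ∷ B) (r ∷ R) (unsegment pre ++ z ∷ Z)) ⟨
  countPairs i ((b ∷ B ++ r ∷ R) ++ unsegment pre ++ z ∷ Z)
    ≡⟨ cong (λ u → countPairs i ((b ∷ B ++ r ∷ R) ++ u)) e ⟩
  countPairs i ((b ∷ B ++ r ∷ R) ++ w ∷ W)
    ≡⟨ countPairs-++∷ i (b ∷ B ++ r ∷ R) w W ⟩
  countPairs i ((b ∷ B ++ r ∷ R) ++ [ w ]) + countPairs i (w ∷ W)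
    ≡⟨ cong₂ _+_ (trans (cong (countPairs i) (++-assoc (b ∷ B) (r ∷ R) [ w ])) (countPairs-segment b B r R w lo hi w<i))
                 (cong (countPairs i) (sym e)) ⟩
  suc (countPairs i (unsegment pre ++ z ∷ Z))
    ≡⟨ cong suc (countPairs-segments pre z Z v v′ z<i) ⟩
  suc (length pre + countPairs i (z ∷ Z)) ∎
  where open ≡-Reasoning

-- The low runs at threshold i + 1, from those at threshold i and the FZ step m and label w of the letter i.
insertLow : List (List ℕ) → Step → ℕ → ℕ → List (List ℕ)
insertLow [] m w i = []
insertLow (B ∷ Bs) m (suc w) i = B ∷ insertLow Bs m w i
insertLow (B ∷ Bs) U zero i = B ∷ [ i ] ∷ Bs
insertLow (B ∷ Bs) H zero i = (B ++ [ i ]) ∷ Bs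
insertLow (B ∷ []) D zero i = B ∷ []
insertLow (B ∷ B′ ∷ Bs) D zero i = (B ++ i ∷ B′) ∷ Bs
insertLow (B ∷ []) H̃ zero i = B ∷ []
insertLow (B ∷ B′ ∷ Bs) H̃ zero i = B ∷ (i ∷ B′) ∷ Bs

Admissible : Step → ℕ → ℕ → Set
Admissible U w l = w < l
Admissible D w l = suc w < l
Admissible H w l = w < l
Admissible H̃ w l = suc w < l

Admissible-pred : ∀ m {w l} → Admissible m (suc w) (suc l) → Admissible m w l
Admissible-pred U (s≤s p) = p
Admissible-pred D (s≤s p) = p
Admissible-pred H (s≤s p) = p
Admissible-pred H̃ (s≤s p) = p

Admissible-shift : ∀ m k {l} → Admissible m 0 l → Admissible m k (k + l)
Admissible-shift U k p = m<m+n k p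
Admissible-shift H k p = m<m+n k p
Admissible-shift D k {l} p = subst (_< k + l) (+-comm k 1) (+-monoʳ-< k p)
Admissible-shift H̃ k {l} p = subst (_< k + l) (+-comm k 1) (+-monoʳ-< k p)

¬Admissible-0 : ∀ m {w} → ¬ Admissible m w 0
¬Admissible-0 U ()
¬Admissible-0 D ()
¬Admissible-0 H ()
¬Admissible-0 H̃ ()

insertLow-skip : ∀ Ps Z m i → insertLow (Ps ++ Z) m (length Ps) i ≡ Ps ++ insertLow Z m 0 i
insertLow-skip [] Z m i = refl
insertLow-skip (P ∷ Ps) Z m i = cong (P ∷_) (insertLow-skip Ps Z m i)

record Raised (i : ℕ) (Ds : List Seg) (m : Step) (w : ℕ) : Set where
  constructor raised
  field
    segs : List Seg
    segmentation : Segmentation (suc i) segs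
    unsegment-≡ : unsegment segs ≡ unsegment Ds
    lows-≡ : lows segs ≡ insertLow (lows Ds) m w i
    admissible : Admissible m w (length Ds)

raised-after : ∀ {i m} pre E E′ → Segmentation (suc i) pre → Segmentation (suc i) E′ →
  unsegment E′ ≡ unsegment E → lows E′ ≡ insertLow (lows E) m 0 i → Admissible m 0 (length E) →
  Raised i (pre ++ E) m (length pre)
raised-after {i} {m} pre E E′ v v′ u l a =
  raised (pre ++ E′) (++⁺ v v′) unsegment-≡ lows-≡
    (subst (Admissible m (length pre)) (sym (length-++ pre)) (Admissible-shift m (length pre) a))
  where
  open ≡-Reasoning
  unsegment-≡ : unsegment (pre ++ E′) ≡ unsegment (pre ++ E)
  unsegment-≡ = begin
    unsegment (pre ++ E′)         ≡⟨ unsegment-++ pre E′ ⟩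
    unsegment pre ++ unsegment E′ ≡⟨ cong (unsegment pre ++_) u ⟩
    unsegment pre ++ unsegment E  ≡⟨ unsegment-++ pre E ⟨
    unsegment (pre ++ E)          ∎
  lows-≡ : lows (pre ++ E′) ≡ insertLow (lows (pre ++ E)) m (length pre) i
  lows-≡ = begin
    lows (pre ++ E′)                                       ≡⟨ map-++ proj₁ pre E′ ⟩
    lows pre ++ lows E′                                    ≡⟨ cong (lows pre ++_) l ⟩
    lows pre ++ insertLow (lows E) m 0 i                   ≡⟨ insertLow-skip (lows pre) (lows E) m i ⟨
    insertLow (lows pre ++ lows E) m (length (lows pre)) i ≡⟨ cong₂ (λ z k → insertLow z m k i)
                                                                    (sym (map-++ proj₁ pre E)) (length-map proj₁ pre) ⟩
    insertLow (lows (pre ++ E)) m (length pre) i           ∎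

raise-located : ∀ {i} pre B X Y post → Segmentation (suc i) pre →
  NonEmpty B → All (_< i) B → All (i <_) X → All (i <_) Y →
  Segmentation (suc i) post → NonEmpty (Y ++ unsegment post) →
  Raised i (pre ++ (B , X ++ i ∷ Y) ∷ post) (classify (nonEmpty? X) (nonEmpty? Y)) (length pre)
raise-located {i} pre B (x ∷ X) (y ∷ Y) post vpre neB lo hiX hiY vpost _ =
  raised-after pre _ ((B , x ∷ X) ∷ ([ i ] , y ∷ Y) ∷ post) vpre
    ((neB , All.map m<n⇒m<1+n lo , tt , hiX) ∷ (tt , ≤-refl ∷ [] , tt , hiY) ∷ vpost)
    (cong (B ++_) (sym (++-assoc (x ∷ X) (i ∷ y ∷ Y) (unsegment post)))) refl (s≤s z≤n)
raise-located {i} pre B [] (y ∷ Y) post vpre neB lo _ hiY vpost _ =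
  raised-after pre _ ((B ++ [ i ] , y ∷ Y) ∷ post) vpre
    ((NonEmpty-++ˡ [ i ] neB , ++⁺ (All.map m<n⇒m<1+n lo) (≤-refl ∷ []) , tt , hiY) ∷ vpost)
    (++-assoc B [ i ] (y ∷ Y ++ unsegment post)) refl (s≤s z≤n)
raise-located {i} pre B [] [] ((B₂ , R₂) ∷ post) vpre neB lo _ _ ((_ , lo₂ , neR₂ , hi₂) ∷ vpost) _ =
  raised-after pre _ ((B ++ i ∷ B₂ , R₂) ∷ post) vpre
    ((NonEmpty-++ˡ (i ∷ B₂) neB , ++⁺ (All.map m<n⇒m<1+n lo) (≤-refl ∷ lo₂) , neR₂ , hi₂) ∷ vpost)
    (++-assoc B (i ∷ B₂) (R₂ ++ unsegment post)) refl (s≤s (s≤s z≤n))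
raise-located {i} pre B (x ∷ X) [] ((B₂ , R₂) ∷ post) vpre neB lo hiX _ ((_ , lo₂ , neR₂ , hi₂) ∷ vpost) _ =
  raised-after pre _ ((B , x ∷ X) ∷ (i ∷ B₂ , R₂) ∷ post) vpre
    ((neB , All.map m<n⇒m<1+n lo , tt , hiX) ∷ (tt , ≤-refl ∷ lo₂ , neR₂ , hi₂) ∷ vpost)
    (cong (B ++_) (sym (++-assoc (x ∷ X) [ i ] (B₂ ++ R₂ ++ unsegment post)))) refl (s≤s (s≤s z≤n))

-- The letter i sits in the high run X ++ i ∷ Y; its left neighbour is high iff X is nonempty,
-- its right neighbour iff Y is nonempty.
lastOr-located : ∀ {i} L pre B X → 0 ∷ L ≡ unsegment pre ++ B ++ X →
  NonEmpty B → All (_< i) B → All (i <_) X → (i <ᵇ lastOr 0 L) ≡ nonEmpty? X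
lastOr-located {i} L pre (b ∷ B) [] e _ lo _ =
  trans (cong (i <ᵇ_) (trans (lastOr-∷≡ 0 L (unsegment pre) b (B ++ []) e) (cong (lastOr b) (++-identityʳ B))))
        (<ᵇ-false (<⇒≤ (lastOr-All b B lo)))
lastOr-located {i} L pre (b ∷ B) (x ∷ X) e _ _ hi =
  trans (cong (i <ᵇ_) (trans (lastOr-∷≡ 0 L (unsegment pre) b (B ++ x ∷ X) e) (lastOr-++ b B x X)))
        (<ᵇ-true (lastOr-All x X hi))

ltNext-located : ∀ {i} Y post → NonEmpty (Y ++ unsegment post) → All (i <_) Y → Segmentation (suc i) post →
  ltNext i (Y ++ unsegment post) ≡ nonEmpty? Y
ltNext-located (y ∷ Y) post _ (p ∷ _) _ = <ᵇ-true p
ltNext-located [] [] () _ _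
ltNext-located [] ((b ∷ _ , _) ∷ _) _ _ ((_ , b<1+i ∷ _ , _) ∷ _) = <ᵇ-false (≤-pred b<1+i)

countPairs-located : ∀ {i} pre B X → Segmentation i pre → Segmentation (suc i) pre →
  NonEmpty B → All (_< i) B → All (i ≤_) X → countPairs i (unsegment pre ++ B ++ X) ≡ length pre
countPairs-located pre (b ∷ B) X v v′ _ lo hi =
  trans (countPairs-segments pre b (B ++ X) v v′ (All.head lo))
        (trans (cong (length pre +_) (countPairs-lowHigh b B X lo hi)) (+-identityʳ _))

raise : ∀ {i} Ds L R → 0 < i → Segmentation i Ds → unsegment Ds ≡ 0 ∷ L ++ i ∷ R →
  All (_≢ i) L → All (_≢ i) R → NonEmpty R →
  Raised i Ds (proj₁ (fzAt (L ++ i ∷ R) i)) (proj₂ (fzAt (L ++ i ∷ R) i))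
raise {i} Ds L R 0<i v eq i∉L i∉R neR with locate Ds (0 ∷ L) R v eq
... | location pre B X Y post refl eP refl =
  subst (λ s → Raised i Ds (proj₁ s) (proj₂ s)) (sym fzAt-≡)
    (raise-located pre B X Y post vpre′ neB lo hiX hiY vpost′ neR)
  where
  vpre = ++⁻ˡ pre v
  vmid = ++⁻ʳ pre v
  neB = proj₁ (All.head vmid)
  lo = proj₁ (proj₂ (All.head vmid))
  hiXiY = proj₂ (proj₂ (proj₂ (All.head vmid)))
  i∉left : All (_≢ i) (unsegment pre ++ B ++ X)
  i∉left = subst (All (_≢ i)) eP ((λ e → <-irrefl e 0<i) ∷ i∉L)
  vpre′ = raise-segmentation pre vpre (++⁻ˡ (unsegment pre) i∉left)
  vpost′ = raise-segmentation post (All.tail vmid) (++⁻ʳ Y i∉R)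
  hiX = strictify X (++⁻ˡ X hiXiY) (++⁻ʳ B (++⁻ʳ (unsegment pre) i∉left))
  hiY = strictify Y (All.tail (++⁻ʳ X hiXiY)) (++⁻ˡ Y i∉R)
  fzAt-≡ : fzAt (L ++ i ∷ Y ++ unsegment post) i ≡ (classify (nonEmpty? X) (nonEmpty? Y) , length pre)
  fzAt-≡ = trans (fzAt-split i L _ i∉L)
    (cong₂ _,_ (cong₂ classify (lastOr-located L pre B X eP neB lo hiX) (ltNext-located Y post neR hiY vpost′))
               (trans (cong (countPairs i) eP) (countPairs-located pre B X vpre vpre′ neB lo (++⁻ˡ X hiXiY))))

OccursOnce : ℕ → List ℕ → Set
OccursOnce j σ = Σ (List ℕ) λ L → Σ (List ℕ) λ R → (σ ≡ L ++ j ∷ R) × All (_≢ j) L × All (_≢ j) R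

fzAt-∷ʳ : ∀ {j σ M} → OccursOnce j σ → j < M → fzAt (σ ++ [ M ]) j ≡ fzAt σ j
fzAt-∷ʳ {j} {σ} {M} (L , R , refl , i∉L , _) j<M
  rewrite ++-assoc L (j ∷ R) [ M ] | fzAt-split j L R i∉L | fzAt-split j L (R ++ [ M ]) i∉L =
  cong (λ b → classify _ b , _) (ltNext-∷ʳ R)
  where
  ltNext-∷ʳ : ∀ R → ltNext j (R ++ [ M ]) ≡ ltNext j R
  ltNext-∷ʳ [] = <ᵇ-true j<M
  ltNext-∷ʳ (_ ∷ _) = refl

raise-framed : ∀ {i σ M} Ds → OccursOnce i σ → 0 < i → i < M → Segmentation i Ds →
  unsegment Ds ≡ 0 ∷ σ ++ [ M ] → Raised i Ds (proj₁ (fzAt σ i)) (proj₂ (fzAt σ i))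
raise-framed {i} {σ} {M} Ds occ@(L , R , refl , i∉L , i∉R) 0<i i<M v eq =
  subst (λ s → Raised i Ds (proj₁ s) (proj₂ s)) (fzAt-∷ʳ occ i<M)
    (subst (λ z → Raised i Ds (proj₁ (fzAt z i)) (proj₂ (fzAt z i))) (sym (++-assoc L (i ∷ R) [ M ]))
      (raise Ds L (R ++ [ M ]) 0<i v (trans eq (cong (0 ∷_) (++-assoc L (i ∷ R) [ M ])))
        i∉L (++⁺ i∉R ((λ e → <-irrefl (sym e) i<M) ∷ [])) (NonEmpty-++ʳ R tt)))

findSplit-absent : ∀ i B → All (_≢ i) B → findSplit i B ≡ nothing
findSplit-absent i [] _ = refl
findSplit-absent i (x ∷ B) (p ∷ ps) rewrite ≡ᵇ-false p | findSplit-absent i B ps = refl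

All-<⇒≢ : ∀ {i} B → All (_< i) B → All (_≢ i) B
All-<⇒≢ B = All.map λ p e → <-irrefl e p

classifyRun : List ℕ → List ℕ → ℕ → Step × ℕ
classifyRun [] [] k = (U , k ∸ 1)
classifyRun (_ ∷ _) (_ ∷ _) k = (D , k)
classifyRun (_ ∷ _) [] k = (H , k)
classifyRun [] (_ ∷ _) k = (H̃ , k ∸ 1)

readStep : ℕ → ℕ → List (List ℕ) → Step × ℕ
readStep i k [] = (H , 0)
readStep i k (B ∷ Bs) with findSplit i B
... | nothing = readStep i (suc k) Bs
... | just (X , Y) = classifyRun X Y k

nonEmptyRun : List ℕ → List (List ℕ)
nonEmptyRun [] = []
nonEmptyRun (x ∷ X) = [ x ∷ X ]

removeLow : ℕ → List (List ℕ) → List (List ℕ)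
removeLow i [] = []
removeLow i (B ∷ Bs) with findSplit i B
... | nothing = B ∷ removeLow i Bs
... | just (X , Y) = nonEmptyRun X ++ nonEmptyRun Y ++ Bs

readStep-insertLow : ∀ i k Bs m w → All NonEmpty Bs → All (All (_< i)) Bs → Admissible m w (length Bs) →
  readStep i k (insertLow Bs m w i) ≡ (m , k + w)
readStep-insertLow i k [] m w _ _ a = ⊥-elim (¬Admissible-0 m a)
readStep-insertLow i k (B ∷ Bs) m (suc w) (_ ∷ nes) (lo ∷ los) a rewrite findSplit-absent i B (All-<⇒≢ B lo) =
  trans (readStep-insertLow i (suc k) Bs m w nes los (Admissible-pred m a)) (cong (m ,_) (sym (+-suc k w)))
readStep-insertLow i k (B ∷ Bs) U zero _ (lo ∷ _) _
  rewrite findSplit-absent i B (All-<⇒≢ B lo) | ≡ᵇ-refl i = cong (U ,_) (sym (+-identityʳ k))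
readStep-insertLow i k ((b ∷ B) ∷ Bs) H zero _ (lo ∷ _) _
  rewrite findSplit-first i (b ∷ B) [] (All-<⇒≢ _ lo) = cong (H ,_) (sym (+-identityʳ k))
readStep-insertLow i k ((b ∷ B) ∷ (b′ ∷ B′) ∷ Bs) D zero _ (lo ∷ _) _
  rewrite findSplit-first i (b ∷ B) (b′ ∷ B′) (All-<⇒≢ _ lo) = cong (D ,_) (sym (+-identityʳ k))
readStep-insertLow i k (B ∷ (b′ ∷ B′) ∷ Bs) H̃ zero _ (lo ∷ _) _
  rewrite findSplit-absent i B (All-<⇒≢ B lo) | ≡ᵇ-refl i = cong (H̃ ,_) (sym (+-identityʳ k))
readStep-insertLow i k ([] ∷ Bs) H zero (() ∷ _) _ _
readStep-insertLow i k ([] ∷ Bs) D zero (() ∷ _) _ _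
readStep-insertLow i k (B ∷ [] ∷ Bs) D zero (_ ∷ () ∷ _) _ _
readStep-insertLow i k (B ∷ [] ∷ Bs) H̃ zero (_ ∷ () ∷ _) _ _
readStep-insertLow i k (B ∷ []) D zero _ _ (s≤s ())
readStep-insertLow i k (B ∷ []) H̃ zero _ _ (s≤s ())

removeLow-insertLow : ∀ i Bs m w → All NonEmpty Bs → All (All (_< i)) Bs → Admissible m w (length Bs) →
  removeLow i (insertLow Bs m w i) ≡ Bs
removeLow-insertLow i [] m w _ _ a = ⊥-elim (¬Admissible-0 m a)
removeLow-insertLow i (B ∷ Bs) m (suc w) (_ ∷ nes) (lo ∷ los) a rewrite findSplit-absent i B (All-<⇒≢ B lo) =
  cong (B ∷_) (removeLow-insertLow i Bs m w nes los (Admissible-pred m a))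
removeLow-insertLow i (B ∷ Bs) U zero _ (lo ∷ _) _ rewrite findSplit-absent i B (All-<⇒≢ B lo) | ≡ᵇ-refl i = refl
removeLow-insertLow i ((b ∷ B) ∷ Bs) H zero _ (lo ∷ _) _ rewrite findSplit-first i (b ∷ B) [] (All-<⇒≢ _ lo) = refl
removeLow-insertLow i ((b ∷ B) ∷ (b′ ∷ B′) ∷ Bs) D zero _ (lo ∷ _) _
  rewrite findSplit-first i (b ∷ B) (b′ ∷ B′) (All-<⇒≢ _ lo) = refl
removeLow-insertLow i (B ∷ (b′ ∷ B′) ∷ Bs) H̃ zero _ (lo ∷ _) _
  rewrite findSplit-absent i B (All-<⇒≢ B lo) | ≡ᵇ-refl i = refl
removeLow-insertLow i ([] ∷ Bs) H zero (() ∷ _) _ _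
removeLow-insertLow i ([] ∷ Bs) D zero (() ∷ _) _ _
removeLow-insertLow i (B ∷ [] ∷ Bs) D zero (_ ∷ () ∷ _) _ _
removeLow-insertLow i (B ∷ [] ∷ Bs) H̃ zero (_ ∷ () ∷ _) _ _
removeLow-insertLow i (B ∷ []) D zero _ _ (s≤s ())
removeLow-insertLow i (B ∷ []) H̃ zero _ _ (s≤s ())

insertLow-lowRuns : ∀ i Bs m w → All NonEmpty Bs → All (All (_< i)) Bs → Admissible m w (length Bs) →
  All NonEmpty (insertLow Bs m w i) × All (All (_< suc i)) (insertLow Bs m w i)
insertLow-lowRuns i [] m w _ _ a = ⊥-elim (¬Admissible-0 m a)
insertLow-lowRuns i (B ∷ Bs) m (suc w) (ne ∷ nes) (lo ∷ los) a
  with insertLow-lowRuns i Bs m w nes los (Admissible-pred m a)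
... | nes′ , los′ = ne ∷ nes′ , All.map m<n⇒m<1+n lo ∷ los′
insertLow-lowRuns i (B ∷ Bs) U zero (ne ∷ nes) (lo ∷ los) _ =
  ne ∷ tt ∷ nes , All.map m<n⇒m<1+n lo ∷ (≤-refl ∷ []) ∷ All.map (All.map m<n⇒m<1+n) los
insertLow-lowRuns i (B ∷ Bs) H zero (ne ∷ nes) (lo ∷ los) _ =
  NonEmpty-++ˡ [ i ] ne ∷ nes , ++⁺ (All.map m<n⇒m<1+n lo) (≤-refl ∷ []) ∷ All.map (All.map m<n⇒m<1+n) los
insertLow-lowRuns i (B ∷ B′ ∷ Bs) D zero (ne ∷ _ ∷ nes) (lo ∷ lo′ ∷ los) _ =
  NonEmpty-++ˡ (i ∷ B′) ne ∷ nes ,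
  ++⁺ (All.map m<n⇒m<1+n lo) (≤-refl ∷ All.map m<n⇒m<1+n lo′) ∷ All.map (All.map m<n⇒m<1+n) los
insertLow-lowRuns i (B ∷ B′ ∷ Bs) H̃ zero (ne ∷ _ ∷ nes) (lo ∷ lo′ ∷ los) _ =
  ne ∷ tt ∷ nes , All.map m<n⇒m<1+n lo ∷ (≤-refl ∷ All.map m<n⇒m<1+n lo′) ∷ All.map (All.map m<n⇒m<1+n) los
insertLow-lowRuns i (B ∷ []) D zero _ _ (s≤s ())
insertLow-lowRuns i (B ∷ []) H̃ zero _ _ (s≤s ())

heightChange : Step → ℕ → ℕ
heightChange U l = suc l
heightChange D l = l ∸ 1
heightChange H l = l
heightChange H̃ l = l

length-insertLow : ∀ i Bs m w → Admissible m w (length Bs) → length (insertLow Bs m w i) ≡ heightChange m (length Bs)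
length-insertLow i [] m w a = ⊥-elim (¬Admissible-0 m a)
length-insertLow i (B ∷ Bs) U (suc w) a = cong suc (length-insertLow i Bs U w (Admissible-pred U a))
length-insertLow i (B ∷ Bs) H (suc w) a = cong suc (length-insertLow i Bs H w (Admissible-pred H a))
length-insertLow i (B ∷ Bs) H̃ (suc w) a = cong suc (length-insertLow i Bs H̃ w (Admissible-pred H̃ a))
length-insertLow i (B ∷ B′ ∷ Bs) D (suc w) (s≤s a) = cong suc (length-insertLow i (B′ ∷ Bs) D w a)
length-insertLow i (B ∷ []) D (suc w) (s≤s ())
length-insertLow i (B ∷ Bs) U zero a = refl
length-insertLow i (B ∷ Bs) H zero a = refl
length-insertLow i (B ∷ B′ ∷ Bs) D zero a = refl
length-insertLow i (B ∷ []) D zero (s≤s ())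
length-insertLow i (B ∷ B′ ∷ Bs) H̃ zero a = refl
length-insertLow i (B ∷ []) H̃ zero (s≤s ())

insertLows : ℕ → List (List ℕ) → List Step → List ℕ → List (List ℕ)
insertLows i Bs (m ∷ P) (w ∷ W) = insertLows (suc i) (insertLow Bs m w i) P W
insertLows i Bs _ _ = Bs

AdmissiblePath : ℕ → List (List ℕ) → List Step → List ℕ → Set
AdmissiblePath i Bs [] [] = ⊤
AdmissiblePath i Bs (m ∷ P) (w ∷ W) = Admissible m w (length Bs) × AdmissiblePath (suc i) (insertLow Bs m w i) P W
AdmissiblePath i Bs _ _ = ⊥

insertLows-injective : ∀ i Bs Bs′ P P′ W W′ → length P ≡ length P′ →
  All NonEmpty Bs → All (All (_< i)) Bs → All NonEmpty Bs′ → All (All (_< i)) Bs′ →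
  AdmissiblePath i Bs P W → AdmissiblePath i Bs′ P′ W′ →
  insertLows i Bs P W ≡ insertLows i Bs′ P′ W′ → Bs ≡ Bs′ × P ≡ P′ × W ≡ W′
insertLows-injective i Bs Bs′ [] [] [] [] _ _ _ _ _ _ _ e = e , refl , refl
insertLows-injective i Bs Bs′ (m ∷ P) (m′ ∷ P′) (w ∷ W) (w′ ∷ W′) l ne lo ne′ lo′ (a , as) (a′ , as′) e
  with insertLow-lowRuns i Bs m w ne lo a | insertLow-lowRuns i Bs′ m′ w′ ne′ lo′ a′
... | ne₁ , lo₁ | ne₁′ , lo₁′
  with insertLows-injective (suc i) _ _ P P′ W W′ (suc-injective l) ne₁ lo₁ ne₁′ lo₁′ as as′ e
... | eBs , refl , refl with readStep-insertLow i 0 Bs m w ne lo a | readStep-insertLow i 0 Bs′ m′ w′ ne′ lo′ a′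
... | r | r′ with trans (sym r) (trans (cong (readStep i 0) eBs) r′)
... | refl = trans (sym (removeLow-insertLow i Bs m w ne lo a))
                   (trans (cong (removeLow i) eBs) (removeLow-insertLow i Bs′ m w ne′ lo′ a′)) ,
             refl , refl
insertLows-injective i Bs Bs′ [] [] [] (_ ∷ _) _ _ _ _ _ _ () _
insertLows-injective i Bs Bs′ [] [] (_ ∷ _) _ _ _ _ _ _ () _ _
insertLows-injective i Bs Bs′ (_ ∷ _) (_ ∷ _) [] _ _ _ _ _ _ () _ _
insertLows-injective i Bs Bs′ (_ ∷ _) (_ ∷ _) (_ ∷ _) [] _ _ _ _ _ _ () _

data UpDown : Step → Set where
  up : UpDown U
  down : UpDown D

LB⇒UpDown : ∀ h P W → LB h P W → All UpDown P
LB⇒UpDown h [] W _ = []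
LB⇒UpDown h (U ∷ P) (_ ∷ W) (_ , lb) = up ∷ LB⇒UpDown (suc h) P W lb
LB⇒UpDown h (D ∷ P) (_ ∷ W) (_ , lb) = down ∷ LB⇒UpDown (h ∸ 1) P W lb
LB⇒UpDown h (U ∷ P) [] ()
LB⇒UpDown h (D ∷ P) [] ()
LB⇒UpDown h (H ∷ P) (_ ∷ _) ()
LB⇒UpDown h (H ∷ P) [] ()
LB⇒UpDown h (H̃ ∷ P) (_ ∷ _) ()
LB⇒UpDown h (H̃ ∷ P) [] ()

suc[n∸1]≡n : ∀ {m n} → m < n → suc (n ∸ 1) ≡ n
suc[n∸1]≡n {n = suc n} _ = refl

-- The number of low runs is one more than the height of the path.
AdmissiblePath⇒LB : ∀ i Bs h P W → length Bs ≡ suc h → All UpDown P → AdmissiblePath i Bs P W → LB h P W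
AdmissiblePath⇒LB i Bs h [] [] _ _ _ = tt
AdmissiblePath⇒LB i Bs h (U ∷ P) (w ∷ W) l (up ∷ uds) (a , as) =
  ≤-pred (subst (w <_) l a) ,
  AdmissiblePath⇒LB (suc i) _ (suc h) P W (trans (length-insertLow i Bs U w a) (cong suc l)) uds as
AdmissiblePath⇒LB i Bs h (D ∷ P) (w ∷ W) l (down ∷ uds) (a , as) =
  ≤-pred (subst (suc w <_) l a) ,
  AdmissiblePath⇒LB (suc i) _ (h ∸ 1) P W
    (trans (length-insertLow i Bs D w a) (trans (cong (_∸ 1) l) (sym (suc[n∸1]≡n (≤-pred (subst (suc w <_) l a)))))) uds as

LB⇒AdmissiblePath : ∀ i Bs h P W → length Bs ≡ suc h → LB h P W → AdmissiblePath i Bs P W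
LB⇒AdmissiblePath i Bs h [] [] _ _ = tt
LB⇒AdmissiblePath i Bs h (U ∷ P) (w ∷ W) l (w≤h , lb) =
  a , LB⇒AdmissiblePath (suc i) _ (suc h) P W (trans (length-insertLow i Bs U w a) (cong suc l)) lb
  where a = subst (w <_) (sym l) (s≤s w≤h)
LB⇒AdmissiblePath i Bs h (D ∷ P) (w ∷ W) l (w<h , lb) =
  a , LB⇒AdmissiblePath (suc i) _ (h ∸ 1) P W
        (trans (length-insertLow i Bs D w a) (trans (cong (_∸ 1) l) (sym (suc[n∸1]≡n w<h)))) lb
  where a = subst (suc w <_) (sym l) (s≤s w<h)
LB⇒AdmissiblePath i Bs h (U ∷ P) [] _ ()
LB⇒AdmissiblePath i Bs h (D ∷ P) [] _ ()
LB⇒AdmissiblePath i Bs h (H ∷ P) (_ ∷ _) _ ()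
LB⇒AdmissiblePath i Bs h (H ∷ P) [] _ ()
LB⇒AdmissiblePath i Bs h (H̃ ∷ P) (_ ∷ _) _ ()
LB⇒AdmissiblePath i Bs h (H̃ ∷ P) [] _ ()
LB⇒AdmissiblePath i Bs h [] (_ ∷ _) _ ()

-- Sweeping the threshold from 1 to n + 1

interval : ℕ → ℕ → List ℕ
interval a zero = []
interval a (suc k) = a ∷ interval (suc a) k

fzSteps : List ℕ → List ℕ → List Step
fzSteps σ = map (λ j → proj₁ (fzAt σ j))

fzLabels : List ℕ → List ℕ → List ℕ
fzLabels σ = map (λ j → proj₂ (fzAt σ j))

record Swept (n : ℕ) (ys : List ℕ) (i : ℕ) (Bs : List (List ℕ)) (P : List Step) (W : List ℕ) : Set where
  constructor swept
  field
    segs : List Seg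
    segmentation : Segmentation (suc n) segs
    unsegment-≡ : unsegment segs ≡ ys
    lows-≡ : lows segs ≡ insertLows i Bs P W
    admissible : AdmissiblePath i Bs P W

sweep : ∀ n σ M k i Ds → i + k ≡ suc n → 0 < i → n < M → Segmentation i Ds → unsegment Ds ≡ 0 ∷ σ ++ [ M ] →
  (∀ j → i ≤ j → j ≤ n → OccursOnce j σ) →
  Swept n (0 ∷ σ ++ [ M ]) i (lows Ds) (fzSteps σ (interval i k)) (fzLabels σ (interval i k))
sweep n σ M zero i Ds e _ _ v u _ = swept Ds (subst (λ z → Segmentation z Ds) (trans (sym (+-identityʳ i)) e) v) u refl tt
sweep n σ M (suc k) i Ds e 0<i n<M v u occ =
  swept segs segmentation unsegment-≡ lows-≡ (subst (Admissible m w) (sym (length-map proj₁ Ds)) admissible , admissible′)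
  where
  i≤n : i ≤ n
  i≤n = ≤-pred (subst (suc i ≤_) e (m<m+n i (s≤s z≤n)))
  m = proj₁ (fzAt σ i)
  w = proj₂ (fzAt σ i)
  r = raise-framed Ds (occ i ≤-refl i≤n) 0<i (≤-<-trans i≤n n<M) v u
  rest = subst (λ Bs → Swept n _ (suc i) Bs _ _) (Raised.lows-≡ r)
           (sweep n σ M k (suc i) (Raised.segs r) (trans (sym (+-suc i k)) e) (s≤s z≤n) n<M
             (Raised.segmentation r) (trans (Raised.unsegment-≡ r) u) (λ j p q → occ j (<⇒≤ p) q))
  open Raised r using (admissible)
  open Swept rest renaming (admissible to admissible′)

-- Complementation and reverse-complement symmetry

compl : ℕ → ℕ → ℕ
compl n v = suc (2 * n) ∸ v

revCompl : ℕ → List ℕ → List ℕ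
revCompl n l = reverse (map (compl n) l)

2n+1≡1+n+n : ∀ n → suc (2 * n) ≡ suc n + n
2n+1≡1+n+n n = cong (λ z → suc (n + z)) (+-identityʳ n)

compl-involutive : ∀ n {v} → v ≤ suc (2 * n) → compl n (compl n v) ≡ v
compl-involutive n p = m∸[m∸n]≡n p

compl-low : ∀ n {v} → v < suc n → suc n ≤ compl n v
compl-low n {v} (s≤s p) = subst (λ K → suc n ≤ K ∸ v) (sym (2n+1≡1+n+n n))
  (≤-trans (≤-reflexive (sym (m+n∸n≡m (suc n) n))) (∸-monoʳ-≤ (suc n + n) p))

compl-high : ∀ n {v} → suc n ≤ v → compl n v < suc n
compl-high n {v} p = subst (λ K → K ∸ v < suc n) (sym (2n+1≡1+n+n n))
  (s≤s (≤-trans (∸-monoʳ-≤ (suc n + n) p) (≤-reflexive (m+n∸m≡n (suc n) n))))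

compl-reflects-< : ∀ n {x y} → compl n x < compl n y → y < x
compl-reflects-< n {x} {y} p with y <? x
... | yes q = q
... | no q = ⊥-elim (<⇒≱ p (∸-monoʳ-≤ (suc (2 * n)) (≮⇒≥ q)))

compl-mono-< : ∀ n {x y} → x < y → y ≤ suc (2 * n) → compl n y < compl n x
compl-mono-< n p q = ∸-monoʳ-< p q

InRange : ℕ → ℕ → Set
InRange n v = 1 ≤ v × v ≤ 2 * n

compl-InRange : ∀ n {v} → InRange n v → InRange n (compl n v)
compl-InRange n (p , q) =
  subst (1 ≤_) (sym (+-∸-assoc 1 q)) (s≤s z≤n) , ∸-monoʳ-≤ (suc (2 * n)) p

InRange⇒≤2n+1 : ∀ n {v} → InRange n v → v ≤ suc (2 * n)
InRange⇒≤2n+1 n (_ , q) = m≤n⇒m≤1+n q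

All-reverse : ∀ {A : Set} {P : A → Set} xs → All P xs → All P (reverse xs)
All-reverse xs = All-resp-↭ (↭-sym (↭-reverse xs))

All-revCompl : ∀ {P Q : ℕ → Set} n u → (∀ {v} → P v → Q (compl n v)) → All P u → All Q (revCompl n u)
All-revCompl n u f a = All-reverse (map (compl n) u) (map⁺ (All.map f a))

map-compl-involutive : ∀ n t → All (_≤ suc (2 * n)) t → map (compl n) (map (compl n) t) ≡ t
map-compl-involutive n t r = trans (sym (map-∘ t)) (map-id-local (All.map (compl-involutive n) r))

revCompl-++ : ∀ n X Y → revCompl n (X ++ Y) ≡ revCompl n Y ++ revCompl n X
revCompl-++ n X Y = trans (cong reverse (map-++ (compl n) X Y)) (reverse-++ (map (compl n) X) (map (compl n) Y))

revCompl-∷ : ∀ n x xs → revCompl n (x ∷ xs) ≡ revCompl n xs ∷ʳ compl n x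
revCompl-∷ n x xs = unfold-reverse (compl n x) (map (compl n) xs)

revCompl-involutive : ∀ n X → All (_≤ suc (2 * n)) X → revCompl n (revCompl n X) ≡ X
revCompl-involutive n X p = begin
  reverse (map (compl n) (reverse (map (compl n) X))) ≡⟨ cong reverse (reverse-map (compl n) (map (compl n) X)) ⟩
  reverse (reverse (map (compl n) (map (compl n) X))) ≡⟨ reverse-involutive _ ⟩
  map (compl n) (map (compl n) X)                     ≡⟨ map-compl-involutive n X p ⟩
  X                                                   ∎
  where open ≡-Reasoning

length-revCompl : ∀ n X → length (revCompl n X) ≡ length X
length-revCompl n X = trans (length-reverse (map (compl n) X)) (length-map (compl n) X)

NonEmpty-revCompl : ∀ n X → NonEmpty X → NonEmpty (revCompl n X)
NonEmpty-revCompl n (x ∷ X) _ = subst NonEmpty (sym (revCompl-∷ n x X)) (NonEmpty-++ʳ (revCompl n X) tt)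

-- The segmentation at n + 1 of a word that is its own reverse complement
-- pairs each low run with the reverse complement of the mirror-image low run.

mirror : ℕ → List Seg → List Seg
mirror n Ds = reverse (map (λ { (B , R) → revCompl n R , revCompl n B }) Ds)

unsegment-mirror : ∀ n Ds → unsegment (mirror n Ds) ≡ revCompl n (unsegment Ds)
unsegment-mirror n [] = refl
unsegment-mirror n ((B , R) ∷ Ds) = begin
  unsegment (reverse (_ ∷ map _ Ds))                              ≡⟨ cong unsegment (unfold-reverse _ (map _ Ds)) ⟩
  unsegment (mirror n Ds ++ [ (revCompl n R , revCompl n B) ])    ≡⟨ unsegment-++ (mirror n Ds) _ ⟩
  unsegment (mirror n Ds) ++ revCompl n R ++ revCompl n B ++ []   ≡⟨ cong₂ (λ u v → u ++ revCompl n R ++ v)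
                                                                            (unsegment-mirror n Ds) (++-identityʳ _) ⟩
  revCompl n (unsegment Ds) ++ revCompl n R ++ revCompl n B       ≡⟨ ++-assoc (revCompl n (unsegment Ds)) _ _ ⟨
  (revCompl n (unsegment Ds) ++ revCompl n R) ++ revCompl n B     ≡⟨ cong (_++ revCompl n B) (revCompl-++ n R (unsegment Ds)) ⟨
  revCompl n (R ++ unsegment Ds) ++ revCompl n B                  ≡⟨ revCompl-++ n B (R ++ unsegment Ds) ⟨
  revCompl n (B ++ R ++ unsegment Ds)                             ∎
  where open ≡-Reasoning

mirror-segmentation : ∀ n Ds → Segmentation (suc n) Ds → Segmentation (suc n) (mirror n Ds)
mirror-segmentation n Ds v = All-reverse (map _ Ds) (map⁺ (All.map mirrorSeg v))
  where
  mirrorSeg : ∀ {s} → LowHigh (suc n) s → LowHigh (suc n) (revCompl n (proj₂ s) , revCompl n (proj₁ s))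
  mirrorSeg {B , R} (neB , lo , neR , hi) =
    NonEmpty-revCompl n R neR , All-revCompl n R (compl-high n) hi ,
    NonEmpty-revCompl n B neB , All-revCompl n B (compl-low n) lo

symmetricSegs : ℕ → List (List ℕ) → List Seg
symmetricSegs n Bs = zip Bs (reverse (map (revCompl n) Bs))

symmetricWord : ℕ → List (List ℕ) → List ℕ
symmetricWord n Bs = unsegment (symmetricSegs n Bs)

zip-map-proj₁-proj₂ : ∀ {A B : Set} (Ds : List (A × B)) → Ds ≡ zip (map proj₁ Ds) (map proj₂ Ds)
zip-map-proj₁-proj₂ [] = refl
zip-map-proj₁-proj₂ ((a , b) ∷ Ds) = cong ((a , b) ∷_) (zip-map-proj₁-proj₂ Ds)

map-proj₁-zip : ∀ {A B : Set} (X : List A) (Y : List B) → length X ≡ length Y → map proj₁ (zip X Y) ≡ X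
map-proj₁-zip [] [] _ = refl
map-proj₁-zip (x ∷ X) (y ∷ Y) e = cong (x ∷_) (map-proj₁-zip X Y (suc-injective e))

map-proj₂-zip : ∀ {A B : Set} (X : List A) (Y : List B) → length X ≡ length Y → map proj₂ (zip X Y) ≡ Y
map-proj₂-zip [] [] _ = refl
map-proj₂-zip (x ∷ X) (y ∷ Y) e = cong (y ∷_) (map-proj₂-zip X Y (suc-injective e))

symmetricWord-determined : ∀ n Ds → Segmentation (suc n) Ds → revCompl n (unsegment Ds) ≡ unsegment Ds →
  unsegment Ds ≡ symmetricWord n (lows Ds)
symmetricWord-determined n Ds v s = cong unsegment (trans (zip-map-proj₁-proj₂ Ds) (cong (zip (lows Ds)) highs≡))
  where
  Ds≡ : Ds ≡ mirror n Ds
  Ds≡ = segmentation-unique Ds (mirror n Ds) v (mirror-segmentation n Ds v)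
          (trans (sym s) (sym (unsegment-mirror n Ds)))
  highs≡ : map proj₂ Ds ≡ reverse (map (revCompl n) (lows Ds))
  highs≡ = trans (cong (map proj₂) Ds≡)
             (trans (reverse-map proj₂ (map _ Ds))
               (cong reverse (trans (sym (map-∘ Ds)) (map-∘ Ds))))

length-symmetricHighs : ∀ n Bs → length Bs ≡ length (reverse (map (revCompl n) Bs))
length-symmetricHighs n Bs = sym (trans (length-reverse (map (revCompl n) Bs)) (length-map (revCompl n) Bs))

lows-symmetricSegs : ∀ n Bs → lows (symmetricSegs n Bs) ≡ Bs
lows-symmetricSegs n Bs = map-proj₁-zip Bs _ (length-symmetricHighs n Bs)

All-zip : ∀ {A B : Set} {P : A → Set} {Q : B → Set} {X Y} → All P X → All Q Y →
  All (λ z → P (proj₁ z) × Q (proj₂ z)) (zip X Y)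
All-zip [] _ = []
All-zip (_ ∷ _) [] = []
All-zip (px ∷ ps) (qy ∷ qs) = (px , qy) ∷ All-zip ps qs

symmetricSegs-segmentation : ∀ n Bs → All NonEmpty Bs → All (All (_< suc n)) Bs →
  Segmentation (suc n) (symmetricSegs n Bs)
symmetricSegs-segmentation n Bs nes los =
  All.map (λ { ((neB , lo) , (neR , hi)) → neB , lo , neR , hi }) (All-zip (All.zip (nes , los)) highs)
  where
  highs : All (λ R → NonEmpty R × All (suc n ≤_) R) (reverse (map (revCompl n) Bs))
  highs = All-reverse (map (revCompl n) Bs)
            (map⁺ (All.map (λ { {B} (neB , lo) → NonEmpty-revCompl n B neB , All-revCompl n B (compl-low n) lo })
                           (All.zip (nes , los))))

reverse-zip : ∀ {A B : Set} (X : List A) (Y : List B) → length X ≡ length Y → reverse (zip X Y) ≡ zip (reverse X) (reverse Y)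
reverse-zip [] [] _ = refl
reverse-zip (x ∷ X) (y ∷ Y) e = begin
  reverse ((x , y) ∷ zip X Y)                        ≡⟨ unfold-reverse (x , y) (zip X Y) ⟩
  reverse (zip X Y) ∷ʳ (x , y)                       ≡⟨ cong (_∷ʳ (x , y)) (reverse-zip X Y (suc-injective e)) ⟩
  zip (reverse X) (reverse Y) ∷ʳ (x , y)             ≡⟨ zip-∷ʳ (reverse X) (reverse Y) lengths ⟨
  zip (reverse X ∷ʳ x) (reverse Y ∷ʳ y)              ≡⟨ cong₂ zip (unfold-reverse x X) (unfold-reverse y Y) ⟨
  zip (reverse (x ∷ X)) (reverse (y ∷ Y))            ∎
  where
  open ≡-Reasoning
  lengths = trans (length-reverse X) (trans (suc-injective e) (sym (length-reverse Y)))
  zip-∷ʳ : ∀ (X′ : List _) (Y′ : List _) → length X′ ≡ length Y′ → zip (X′ ∷ʳ x) (Y′ ∷ʳ y) ≡ zip X′ Y′ ∷ʳ (x , y)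
  zip-∷ʳ [] [] _ = refl
  zip-∷ʳ (a ∷ X′) (b ∷ Y′) e′ = cong ((a , b) ∷_) (zip-∷ʳ X′ Y′ (suc-injective e′))

symmetricWord-symmetric : ∀ n Bs → All (All (_< suc n)) Bs → revCompl n (symmetricWord n Bs) ≡ symmetricWord n Bs
symmetricWord-symmetric n Bs los = begin
  revCompl n (unsegment (zip Bs Rs))                        ≡⟨ unsegment-mirror n (zip Bs Rs) ⟨
  unsegment (reverse (map _ (zip Bs Rs)))                   ≡⟨ cong (unsegment ∘ reverse) (map-swap-zip Bs Rs) ⟩
  unsegment (reverse (zip (map (revCompl n) Rs) (map (revCompl n) Bs)))
    ≡⟨ cong unsegment (reverse-zip (map (revCompl n) Rs) (map (revCompl n) Bs)
                         (trans (length-map (revCompl n) Rs) (length-reverse (map (revCompl n) Bs)))) ⟩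
  unsegment (zip (reverse (map (revCompl n) Rs)) Rs)        ≡⟨ cong (λ z → unsegment (zip z Rs)) Bs≡ ⟩
  unsegment (zip Bs Rs)                                     ∎
  where
  open ≡-Reasoning
  Rs = reverse (map (revCompl n) Bs)
  map-swap-zip : ∀ X Y → map (λ { (B , R) → revCompl n R , revCompl n B }) (zip X Y)
                         ≡ zip (map (revCompl n) Y) (map (revCompl n) X)
  map-swap-zip [] [] = refl
  map-swap-zip [] (_ ∷ _) = refl
  map-swap-zip (_ ∷ _) [] = refl
  map-swap-zip (x ∷ X) (y ∷ Y) = cong (_ ∷_) (map-swap-zip X Y)
  Bs≡ : reverse (map (revCompl n) Rs) ≡ Bs
  Bs≡ = begin
    reverse (map (revCompl n) (reverse (map (revCompl n) Bs))) ≡⟨ cong reverse (reverse-map (revCompl n) (map (revCompl n) Bs)) ⟩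
    reverse (reverse (map (revCompl n) (map (revCompl n) Bs))) ≡⟨ reverse-involutive _ ⟩
    map (revCompl n) (map (revCompl n) Bs)                     ≡⟨ map-∘ Bs ⟨
    map (revCompl n ∘ revCompl n) Bs
      ≡⟨ map-id-local (All.map (λ lo → revCompl-involutive n _ (All.map (λ p → ≤-trans (<⇒≤ p) (s≤s (m≤n*m n 2))) lo)) los) ⟩
    Bs                                                         ∎

-- Alternating and zigzag words

Oriented : Bool → ℕ → ℕ → Set
Oriented true x y = x < y
Oriented false x y = y < x

Alternating : Bool → List ℕ → Set
Alternating b [] = ⊤
Alternating b (x ∷ []) = ⊤
Alternating b (x ∷ y ∷ r) = Oriented b x y × Alternating (not b) (y ∷ r)

flips : ℕ → Bool → Bool
flips zero b = b
flips (suc k) b = not (flips k b)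

flips-not : ∀ k b → flips k (not b) ≡ not (flips k b)
flips-not zero b = refl
flips-not (suc k) b = cong not (flips-not k b)

flips-+ : ∀ a c b → flips a (flips c b) ≡ flips (a + c) b
flips-+ zero c b = refl
flips-+ (suc a) c b = cong not (flips-+ a c b)

flips-double : ∀ k b → flips (k + k) b ≡ b
flips-double zero b = refl
flips-double (suc k) b =
  trans (cong (λ z → not (flips z b)) (+-suc k k)) (trans (not-involutive _) (flips-double k b))

Alternating-++ : ∀ b xs x ys → Alternating b (xs ++ [ x ]) → Alternating (flips (length xs) b) (x ∷ ys) →
  Alternating b (xs ++ x ∷ ys)
Alternating-++ b [] x ys _ a = a
Alternating-++ b (a ∷ []) x ys (d , _) a₂ = d , a₂
Alternating-++ b (a ∷ a′ ∷ xs) x ys (d , a₁) a₂ =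
  d , Alternating-++ (not b) (a′ ∷ xs) x ys a₁ (subst (λ c → Alternating c (x ∷ ys)) (sym (flips-not (suc (length xs)) b)) a₂)

Alternating-split : ∀ b xs x ys → Alternating b (xs ++ x ∷ ys) →
  Alternating b (xs ++ [ x ]) × Alternating (flips (length xs) b) (x ∷ ys)
Alternating-split b [] x ys a = tt , a
Alternating-split b (a ∷ []) x ys (d , a₂) = (d , tt) , a₂
Alternating-split b (a ∷ a′ ∷ xs) x ys (d , a₁) with Alternating-split (not b) (a′ ∷ xs) x ys a₁
... | p , q = (d , p) , subst (λ c → Alternating c (x ∷ ys)) (flips-not (suc (length xs)) b) q

Alternating-prefix : ∀ b xs ys → Alternating b (xs ++ ys) → Alternating b xs
Alternating-prefix b [] ys _ = tt
Alternating-prefix b (x ∷ []) ys _ = tt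
Alternating-prefix b (x ∷ x′ ∷ xs) ys (d , a) = d , Alternating-prefix (not b) (x′ ∷ xs) ys a

Oriented-flip : ∀ b {x y} → Oriented b x y → Oriented (not b) y x
Oriented-flip true p = p
Oriented-flip false p = p

Alternating-reverse : ∀ b l → Alternating b l → Alternating (flips (length l) (not b)) (reverse l)
Alternating-reverse b [] _ = tt
Alternating-reverse b (x ∷ []) _ = tt
Alternating-reverse b (x ∷ y ∷ r) (d , a) =
  subst (Alternating _) (sym (unfold-reverse x (y ∷ r)))
    (subst (λ c → Alternating c (reverse (y ∷ r) ∷ʳ x)) c₀≡
      (subst (λ z → Alternating c₀ (z ∷ʳ x)) (sym (unfold-reverse y r))
        (subst (Alternating c₀) (sym (++-assoc (reverse r) [ y ] [ x ]))
          (Alternating-++ c₀ (reverse r) y [ x ]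
            (subst (Alternating c₀) (unfold-reverse y r) (Alternating-reverse (not b) (y ∷ r) a))
            (subst (λ c → Alternating c (y ∷ [ x ])) last≡ (Oriented-flip b d , tt))))))
  where
  c₀ = flips (suc (length r)) (not (not b))
  c₀≡ : c₀ ≡ flips (suc (suc (length r))) (not b)
  c₀≡ = trans (cong (flips (suc (length r))) (not-involutive b))
          (trans (sym (not-involutive _)) (cong not (sym (flips-not (suc (length r)) b))))
  last≡ : not b ≡ flips (length (reverse r)) c₀
  last≡ = sym (trans (cong (λ k → flips k c₀) (length-reverse r))
            (trans (cong (flips (length r)) (cong (flips (suc (length r))) (not-involutive b)))
              (trans (flips-+ (length r) (suc (length r)) b)
                (trans (cong (λ k → flips k b) (+-suc (length r) (length r))) (cong not (flips-double (length r) b))))))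

Alternating-compl : ∀ n b l → Alternating b l → All (_≤ suc (2 * n)) l → Alternating (not b) (map (compl n) l)
Alternating-compl n b [] _ _ = tt
Alternating-compl n b (x ∷ []) _ _ = tt
Alternating-compl n true (x ∷ y ∷ r) (d , a) (_ ∷ py ∷ ps) = compl-mono-< n d py , Alternating-compl n false (y ∷ r) a (py ∷ ps)
Alternating-compl n false (x ∷ y ∷ r) (d , a) (px ∷ py ∷ ps) = compl-mono-< n d px , Alternating-compl n true (y ∷ r) a (py ∷ ps)

Alternating-compl⁻ : ∀ n b l → Alternating (not b) (map (compl n) l) → Alternating b l
Alternating-compl⁻ n b [] _ = tt
Alternating-compl⁻ n b (x ∷ []) _ = tt
Alternating-compl⁻ n true (x ∷ y ∷ r) (d , a) = compl-reflects-< n d , Alternating-compl⁻ n false (y ∷ r) a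
Alternating-compl⁻ n false (x ∷ y ∷ r) (d , a) = compl-reflects-< n d , Alternating-compl⁻ n true (y ∷ r) a

Extremum : ℕ → ℕ → ℕ → Set
Extremum a x c = (x < a × x < c) ⊎ (a < x × c < x)

Zigzag : List ℕ → Set
Zigzag (a ∷ x ∷ c ∷ r) = Extremum a x c × Zigzag (x ∷ c ∷ r)
Zigzag _ = ⊤

Alternating⇒Zigzag : ∀ b l → Alternating b l → Zigzag l
Alternating⇒Zigzag b [] _ = tt
Alternating⇒Zigzag b (x ∷ []) _ = tt
Alternating⇒Zigzag b (x ∷ y ∷ []) _ = tt
Alternating⇒Zigzag true (x ∷ y ∷ z ∷ r) (d , d₂ , a) = inj₂ (d , d₂) , Alternating⇒Zigzag false (y ∷ z ∷ r) (d₂ , a)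
Alternating⇒Zigzag false (x ∷ y ∷ z ∷ r) (d , d₂ , a) = inj₁ (d , d₂) , Alternating⇒Zigzag true (y ∷ z ∷ r) (d₂ , a)

Zigzag⇒Alternating : ∀ b x y r → Zigzag (x ∷ y ∷ r) → Oriented b x y → Alternating b (x ∷ y ∷ r)
Zigzag⇒Alternating b x y [] _ d = d , tt
Zigzag⇒Alternating true x y (z ∷ r) (inj₁ (p , _) , e) d = ⊥-elim (<-asym p d)
Zigzag⇒Alternating true x y (z ∷ r) (inj₂ (_ , q) , e) d = d , Zigzag⇒Alternating false y z r e q
Zigzag⇒Alternating false x y (z ∷ r) (inj₁ (_ , q) , e) d = d , Zigzag⇒Alternating true y z r e q
Zigzag⇒Alternating false x y (z ∷ r) (inj₂ (p , _) , e) d = ⊥-elim (<-asym p d)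

Zigzag-middle : ∀ A a x c B → Zigzag (A ++ a ∷ x ∷ c ∷ B) → Extremum a x c
Zigzag-middle [] a x c B (e , _) = e
Zigzag-middle (p ∷ A) a x c B z = Zigzag-middle A a x c B (Zigzag-tail p (A ++ a ∷ x ∷ c ∷ B) z)
  where
  Zigzag-tail : ∀ p l → Zigzag (p ∷ l) → Zigzag l
  Zigzag-tail p [] _ = tt
  Zigzag-tail p (_ ∷ []) _ = tt
  Zigzag-tail p (_ ∷ _ ∷ []) _ = tt
  Zigzag-tail p (_ ∷ _ ∷ _ ∷ _) (_ , z) = z

Zigzag-intro : ∀ l → (∀ A a x c B → l ≡ A ++ a ∷ x ∷ c ∷ B → Extremum a x c) → Zigzag l
Zigzag-intro [] h = tt
Zigzag-intro (a ∷ []) h = tt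
Zigzag-intro (a ∷ x ∷ []) h = tt
Zigzag-intro (a ∷ x ∷ c ∷ r) h =
  h [] a x c r refl , Zigzag-intro (x ∷ c ∷ r) (λ A a′ x′ c′ B e → h (a ∷ A) a′ x′ c′ B (cong (a ∷_) e))

Extremum-compl⁻ : ∀ n a x c → Extremum (compl n c) (compl n x) (compl n a) → Extremum a x c
Extremum-compl⁻ n a x c (inj₁ (p , q)) = inj₂ (compl-reflects-< n q , compl-reflects-< n p)
Extremum-compl⁻ n a x c (inj₂ (p , q)) = inj₁ (compl-reflects-< n q , compl-reflects-< n p)

-- Counting letters

countᵇ : {A : Set} → (A → Bool) → List A → ℕ
countᵇ p [] = 0
countᵇ p (x ∷ xs) = indicator (p x) + countᵇ p xs

occurrences : ℕ → List ℕ → ℕ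
occurrences j = countᵇ (_≡ᵇ j)

countᵇ-++ : ∀ {A : Set} (p : A → Bool) xs ys → countᵇ p (xs ++ ys) ≡ countᵇ p xs + countᵇ p ys
countᵇ-++ p [] ys = refl
countᵇ-++ p (x ∷ xs) ys = trans (cong (indicator (p x) +_) (countᵇ-++ p xs ys)) (sym (+-assoc (indicator (p x)) _ _))

countᵇ-map : ∀ {A B : Set} (p : B → Bool) (f : A → B) xs → countᵇ p (map f xs) ≡ countᵇ (p ∘ f) xs
countᵇ-map p f [] = refl
countᵇ-map p f (x ∷ xs) = cong (indicator (p (f x)) +_) (countᵇ-map p f xs)

countᵇ-↭ : ∀ {A : Set} (p : A → Bool) {xs ys} → xs ↭ ys → countᵇ p xs ≡ countᵇ p ys
countᵇ-↭ p ↭.refl = refl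
countᵇ-↭ p (↭.prep x r) = cong (indicator (p x) +_) (countᵇ-↭ p r)
countᵇ-↭ p (↭.swap {xs = xs} {ys = ys} x y r) = begin
  indicator (p x) + (indicator (p y) + countᵇ p xs) ≡⟨ +-assoc (indicator (p x)) _ _ ⟨
  indicator (p x) + indicator (p y) + countᵇ p xs   ≡⟨ cong₂ _+_ (+-comm (indicator (p x)) _) (countᵇ-↭ p r) ⟩
  indicator (p y) + indicator (p x) + countᵇ p ys   ≡⟨ +-assoc (indicator (p y)) _ _ ⟩
  indicator (p y) + (indicator (p x) + countᵇ p ys) ∎
  where open ≡-Reasoning
countᵇ-↭ p (↭.trans r s) = trans (countᵇ-↭ p r) (countᵇ-↭ p s)

countᵇ-reverse : ∀ {A : Set} (p : A → Bool) xs → countᵇ p (reverse xs) ≡ countᵇ p xs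
countᵇ-reverse p xs = countᵇ-↭ p (↭-reverse xs)

countᵇ-sum : ∀ {A : Set} (p q r : A → Bool) xs → All (λ x → indicator (p x) + indicator (q x) ≡ indicator (r x)) xs →
  countᵇ p xs + countᵇ q xs ≡ countᵇ r xs
countᵇ-sum p q r [] [] = refl
countᵇ-sum p q r (x ∷ xs) (e ∷ es) =
  trans (+-interchange (indicator (p x)) (countᵇ p xs) (indicator (q x)) (countᵇ q xs))
        (cong₂ _+_ e (countᵇ-sum p q r xs es))

countᵇ-cong : ∀ {A : Set} (p q : A → Bool) xs → All (λ x → p x ≡ q x) xs → countᵇ p xs ≡ countᵇ q xs
countᵇ-cong p q [] [] = refl
countᵇ-cong p q (x ∷ xs) (e ∷ es) = cong₂ _+_ (cong indicator e) (countᵇ-cong p q xs es)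

occurrences-absent : ∀ j xs → All (_≢ j) xs → occurrences j xs ≡ 0
occurrences-absent j [] [] = refl
occurrences-absent j (x ∷ xs) (p ∷ ps) rewrite ≡ᵇ-false p = occurrences-absent j xs ps

occurrences-zero : ∀ j xs → occurrences j xs ≡ 0 → All (_≢ j) xs
occurrences-zero j [] _ = []
occurrences-zero j (x ∷ xs) e with x ≡ᵇ j in eq
... | false = (λ x≡j → subst T eq (≡⇒≡ᵇ x j x≡j)) ∷ occurrences-zero j xs e

occurrences-one : ∀ j xs → occurrences j xs ≡ 1 → OccursOnce j xs
occurrences-one j [] ()
occurrences-one j (x ∷ xs) e with x ≡ᵇ j in eq
... | true = [] , xs , cong (_∷ xs) (≡ᵇ⇒≡ x j (subst T (sym eq) tt)) , [] , occurrences-zero j xs (suc-injective e)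
... | false with occurrences-one j xs e
...   | L , R , refl , j∉L , j∉R = x ∷ L , R , refl , (λ x≡j → subst T eq (≡⇒≡ᵇ x j x≡j)) ∷ j∉L , j∉R

interval-∷ʳ : ∀ a k → interval a (suc k) ≡ interval a k ∷ʳ (a + k)
interval-∷ʳ a zero = cong [_] (sym (+-identityʳ a))
interval-∷ʳ a (suc k) = cong (a ∷_) (trans (interval-∷ʳ (suc a) k) (cong (interval (suc a) k ∷ʳ_) (sym (+-suc a k))))

oneTo-interval : ∀ n → oneTo n ≡ interval 1 n
oneTo-interval n = trans (map-applyUpTo (λ x → x) suc n) (applyUpTo-interval suc 1 n (λ _ → refl))
  where
  applyUpTo-interval : ∀ (f : ℕ → ℕ) a k → (∀ x → f x ≡ a + x) → applyUpTo f k ≡ interval a k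
  applyUpTo-interval f a zero h = refl
  applyUpTo-interval f a (suc k) h =
    cong₂ _∷_ (trans (h 0) (+-identityʳ a)) (applyUpTo-interval (f ∘ suc) (suc a) k (λ x → trans (h (suc x)) (+-suc a x)))

All-interval : ∀ a k → All (λ j → a ≤ j × j < a + k) (interval a k)
All-interval a zero = []
All-interval a (suc k) = (≤-refl , m<m+n a (s≤s z≤n)) ∷ All.map shiftBounds (All-interval (suc a) k)
  where
  shiftBounds : ∀ {j} → suc a ≤ j × j < suc a + k → a ≤ j × j < a + suc k
  shiftBounds {j} (p , q) = <⇒≤ p , subst (j <_) (sym (+-suc a k)) q

occurrences-interval : ∀ j a k → a ≤ j → j < a + k → occurrences j (interval a k) ≡ 1
occurrences-interval j a zero p q = ⊥-elim (<⇒≱ q (subst (_≤ j) (sym (+-identityʳ a)) p))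
occurrences-interval j a (suc k) p q with a ≟ j
... | yes refl rewrite ≡ᵇ-refl a =
  cong suc (occurrences-absent a (interval (suc a) k) (All.map (λ b e → <-irrefl (sym e) (proj₁ b)) (All-interval (suc a) k)))
... | no a≢j rewrite ≡ᵇ-false a≢j = occurrences-interval j (suc a) k (≤∧≢⇒< p a≢j) (subst (j <_) (+-suc a k) q)

occurrences⇒↭ : ∀ n l → length l ≡ n → (∀ k → 1 ≤ k → k ≤ n → occurrences k l ≡ 1) → l ↭ interval 1 n
occurrences⇒↭ zero [] _ _ = ↭-refl
occurrences⇒↭ (suc n) l len h with occurrences-one (suc n) l (h (suc n) (s≤s z≤n) ≤-refl)
... | L , R , refl , n∉L , n∉R =
  ↭-trans (shift (suc n) L R)
    (↭-trans (prep (suc n) (occurrences⇒↭ n (L ++ R) len′ h′))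
      (↭-trans (∷↭∷ʳ (suc n) (interval 1 n)) (↭-reflexive (sym (interval-∷ʳ 1 n)))))
  where
  len′ : length (L ++ R) ≡ n
  len′ = suc-injective (trans (cong suc (length-++ L)) (trans (sym (+-suc (length L) (length R))) (trans (sym (length-++ L)) len)))
  h′ : ∀ k → 1 ≤ k → k ≤ n → occurrences k (L ++ R) ≡ 1
  h′ k p q = begin
    occurrences k (L ++ R)                                    ≡⟨ countᵇ-++ _ L R ⟩
    occurrences k L + occurrences k R                         ≡⟨ cong (λ b → occurrences k L + (indicator b + occurrences k R))
                                                                      (≡ᵇ-false (λ e → <-irrefl (sym e) (s≤s q))) ⟨
    occurrences k L + occurrences k (suc n ∷ R)               ≡⟨ countᵇ-++ _ L (suc n ∷ R) ⟨
    occurrences k (L ++ suc n ∷ R)                            ≡⟨ h k p (m≤n⇒m≤1+n q) ⟩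
    1                                                         ∎
    where open ≡-Reasoning

-- Snakes and the letters π̃ᵢ

untilde : ℕ → ℕ → ℤ
untilde n v with n <? v
... | yes _ = +ℤ (v ∸ n)
... | no _ = -[1+ (n ∸ v) ]

untilde-high : ∀ n v → n < v → untilde n v ≡ +ℤ (v ∸ n)
untilde-high n v p with n <? v
... | yes _ = refl
... | no q = ⊥-elim (q p)

untilde-low : ∀ n v → v ≤ n → untilde n v ≡ -[1+ (n ∸ v) ]
untilde-low n v p with n <? v
... | yes q = ⊥-elim (<⇒≱ q p)
... | no _ = refl

tilde-untilde : ∀ n v → tilde n (untilde n v) ≡ v
tilde-untilde n v with n <? v
... | yes p = m+[n∸m]≡n (<⇒≤ p)
... | no p = m∸[m∸n]≡n (≮⇒≥ p)

SignedInRange : ℕ → ℤ → Set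
SignedInRange n x = 1 ≤ ∣ x ∣ × ∣ x ∣ ≤ n

untilde-tilde : ∀ n x → SignedInRange n x → untilde n (tilde n x) ≡ x
untilde-tilde n (+ℤ a) (p , _) =
  trans (untilde-high n (n + a) (subst (_< n + a) (+-identityʳ n) (+-monoʳ-< n p))) (cong +ℤ_ (m+n∸m≡n n a))
untilde-tilde n -[1+ a ] (_ , s≤s q) =
  trans (untilde-low n (n ∸ a) (m∸n≤m n a)) (cong -[1+_] (m∸[m∸n]≡n (m≤n⇒m≤1+n q)))

tilde-InRange : ∀ n x → SignedInRange n x → InRange n (tilde n x)
tilde-InRange n (+ℤ a) (p , q) = ≤-trans p (m≤n+m a n) , subst (n + a ≤_) (cong (n +_) (sym (+-identityʳ n))) (+-monoʳ-≤ n q)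
tilde-InRange n -[1+ a ] (_ , s≤s q) = m<n⇒0<n∸m (s≤s q) , ≤-trans (m∸n≤m n a) (m≤m+n n (n + 0))

tilde-mono-< : ∀ n {x y} → SignedInRange n x → SignedInRange n y → x <ℤ y → tilde n x < tilde n y
tilde-mono-< n _ _ (+<+ p) = +-monoʳ-< n p
tilde-mono-< n { -[1+ a ]} {+ℤ b} _ (pb , _) -<+ = ≤-<-trans (m∸n≤m n a) (subst (_< n + b) (+-identityʳ n) (+-monoʳ-< n pb))
tilde-mono-< n { -[1+ a ]} { -[1+ b ]} (_ , s≤s qa) _ (-<- p) = ∸-monoʳ-< p (m≤n⇒m≤1+n qa)

untilde-mono-< : ∀ n {v w} → v < w → untilde n v <ℤ untilde n w
untilde-mono-< n {v} {w} p with n <? v | n <? w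
... | yes a | yes b = +<+ (∸-monoˡ-< p (<⇒≤ a))
... | yes a | no b = ⊥-elim (b (<-trans a p))
... | no a | yes b = -<+
... | no a | no b = -<- (∸-monoʳ-< p (≮⇒≥ b))

AltDown⇒Alternating : ∀ n π → All (SignedInRange n) π → AltDown π → Alternating false (map (tilde n) π)
AltUp⇒Alternating : ∀ n π → All (SignedInRange n) π → AltUp π → Alternating true (map (tilde n) π)
AltDown⇒Alternating n [] _ _ = tt
AltDown⇒Alternating n (x ∷ []) _ _ = tt
AltDown⇒Alternating n (x ∷ y ∷ r) (px ∷ py ∷ ps) (d , a) = tilde-mono-< n py px d , AltUp⇒Alternating n (y ∷ r) (py ∷ ps) a
AltUp⇒Alternating n [] _ _ = tt
AltUp⇒Alternating n (x ∷ []) _ _ = tt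
AltUp⇒Alternating n (x ∷ y ∷ r) (px ∷ py ∷ ps) (d , a) = tilde-mono-< n px py d , AltDown⇒Alternating n (y ∷ r) (py ∷ ps) a

Alternating⇒AltDown : ∀ n t → Alternating false t → AltDown (map (untilde n) t)
Alternating⇒AltUp : ∀ n t → Alternating true t → AltUp (map (untilde n) t)
Alternating⇒AltDown n [] _ = tt
Alternating⇒AltDown n (x ∷ []) _ = tt
Alternating⇒AltDown n (x ∷ y ∷ r) (d , a) = untilde-mono-< n d , Alternating⇒AltUp n (y ∷ r) a
Alternating⇒AltUp n [] _ = tt
Alternating⇒AltUp n (x ∷ []) _ = tt
Alternating⇒AltUp n (x ∷ y ∷ r) (d , a) = untilde-mono-< n d , Alternating⇒AltDown n (y ∷ r) a

-- |untilde v| = k + 1 exactly when v = n − k or v = n + k + 1 = compl n (n − k).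
indicator-untilde : ∀ n k v → k < n →
  indicator (v ≡ᵇ (n ∸ k)) + indicator (compl n v ≡ᵇ (n ∸ k)) ≡ indicator (∣ untilde n v ∣ ≡ᵇ suc k)
indicator-untilde n k v k<n with v ≤? n
... | yes v≤n rewrite untilde-low n v v≤n
                    | ≡ᵇ-false {compl n v} {n ∸ k} (λ e → <⇒≱ (s≤s (m∸n≤m n k)) (subst (suc n ≤_) e (compl-low n (s≤s v≤n))))
  = trans (+-identityʳ _) (cong indicator (≡ᵇ-cong
      (λ e → trans (cong (n ∸_) e) (m∸[m∸n]≡n (<⇒≤ k<n)))
      (λ e → trans (sym (m∸[m∸n]≡n v≤n)) (cong (n ∸_) e))))
... | no v≰n rewrite untilde-high n v (≰⇒> v≰n)
                   | ≡ᵇ-false {v} {n ∸ k} (λ e → v≰n (subst (_≤ n) (sym e) (m∸n≤m n k)))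
  = cong indicator (≡ᵇ-cong to from)
  where
  n∸k+1+k : (n ∸ k) + suc k ≡ suc n
  n∸k+1+k = trans (+-suc (n ∸ k) k) (cong suc (m∸n+n≡m (<⇒≤ k<n)))
  2n+1≡ : suc (2 * n) ≡ (n ∸ k) + (suc k + n)
  2n+1≡ = trans (2n+1≡1+n+n n) (trans (cong (_+ n) (sym n∸k+1+k)) (+-assoc (n ∸ k) (suc k) n))
  to : compl n v ≡ n ∸ k → v ∸ n ≡ suc k
  to e = trans (cong (_∸ n) v≡) (m+n∸n≡m (suc k) n)
    where
    v≤2n+1 : v ≤ suc (2 * n)
    v≤2n+1 = ≮⇒≥ λ p → <⇒≱ (m<n⇒0<n∸m k<n) (≤-reflexive (trans (sym e) (m≤n⇒m∸n≡0 (<⇒≤ p))))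
    v≡ : v ≡ suc k + n
    v≡ = +-cancelˡ-≡ (n ∸ k) v (suc k + n)
           (trans (cong (_+ v) (sym e)) (trans (m∸n+n≡m v≤2n+1) 2n+1≡))
  from : v ∸ n ≡ suc k → compl n v ≡ n ∸ k
  from e = trans (cong₂ _∸_ 2n+1≡ v≡) (m+n∸n≡m (n ∸ k) (suc k + n))
    where
    v≡ : v ≡ suc k + n
    v≡ = trans (sym (m∸n+n≡m (<⇒≤ (≰⇒> v≰n)))) (cong (_+ n) e)

complIf : Bool → ℕ → List ℕ → List ℕ
complIf b n t = if b then map (compl n) t else t

complIf-involutive : ∀ b n u → All (_≤ suc (2 * n)) u → complIf b n (complIf b n u) ≡ u
complIf-involutive true n u r = map-compl-involutive n u r
complIf-involutive false n u r = refl

complIf-≤2n+1 : ∀ b n u → All (_≤ suc (2 * n)) u → All (_≤ suc (2 * n)) (complIf b n u)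
complIf-≤2n+1 true n u r = map⁺ (All.universal (λ v → m∸n≤m (suc (2 * n)) v) u)
complIf-≤2n+1 false n u r = r

complIf-InRange : ∀ b n u → All (InRange n) u → All (InRange n) (complIf b n u)
complIf-InRange true n u r = map⁺ (All.map (compl-InRange n) r)
complIf-InRange false n u r = r

length-complIf : ∀ b n t → length (complIf b n t) ≡ length t
length-complIf true n t = length-map (compl n) t
length-complIf false n t = refl

halfOf : ℕ → List ℤ → List ℕ
halfOf n π = complIf (odd n) n (map (tilde n) π)

psi-halves : ∀ n π → All (_≤ suc (2 * n)) (map (tilde n) π) → psi n π ≡ revCompl n (halfOf n π) ++ halfOf n π
psi-halves n π r with odd n
... | true = cong (_++ map (compl n) (map (tilde n) π)) (sym (cong reverse (map-compl-involutive n (map (tilde n) π) r)))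
... | false = refl

parity-view : ∀ n → (Σ ℕ λ k → (n ≡ k + k) × (odd n ≡ false)) ⊎ (Σ ℕ λ k → (n ≡ suc (k + k)) × (odd n ≡ true))
parity-view n with n % 2 | m≡m%n+[m/n]*n n 2 | m%n<n n 2
... | zero | e | _ = inj₁ (n / 2 , trans e (k*2≡k+k (n / 2)) , refl)
  where k*2≡k+k : ∀ k → k * 2 ≡ k + k
        k*2≡k+k k = trans (*-comm k 2) (cong (k +_) (+-identityʳ k))
... | suc zero | e | _ = inj₂ (n / 2 , trans e (cong suc (k*2≡k+k (n / 2))) , refl)
  where k*2≡k+k : ∀ k → k * 2 ≡ k + k
        k*2≡k+k k = trans (*-comm k 2) (cong (k +_) (+-identityʳ k))
... | suc (suc _) | _ | s≤s (s≤s ())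

flips-odd : ∀ n → odd n ≡ true → (flips (suc n) true ≡ true) × (flips n true ≡ false)
flips-odd n o with parity-view n
... | inj₁ (_ , _ , o′) with () ← trans (sym o) o′
... | inj₂ (k , refl , _) = trans (not-involutive _) (flips-double k true) , cong not (flips-double k true)

flips-even : ∀ n → odd n ≡ false → (flips (suc n) true ≡ false) × (flips n true ≡ true)
flips-even n e with parity-view n
... | inj₂ (_ , _ , o) with () ← trans (sym o) e
... | inj₁ (k , refl , _) = cong not (flips-double k true) , flips-double k true

flips-2n+1 : ∀ n → flips n (flips (suc n) true) ≡ false
flips-2n+1 n = trans (flips-+ n (suc n) true) (trans (cong (λ z → flips z true) (+-suc n n)) (cong not (flips-double n true)))

flips-2n+2 : ∀ n → flips n (flips (suc (suc n)) true) ≡ true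
flips-2n+2 n = trans (flips-+ n (suc (suc n)) true) (trans (cong (λ z → flips z true) (+-suc n (suc n))) (flips-double (suc n) true))

∷-∷ʳ-view : ∀ (x : ℕ) xs → Σ (List ℕ) λ ys → Σ ℕ λ y → (x ∷ xs ≡ ys ∷ʳ y) × (length ys ≡ length xs)
∷-∷ʳ-view x [] = [] , x , refl , refl
∷-∷ʳ-view x (x′ ∷ xs) with ∷-∷ʳ-view x′ xs
... | ys , y , e , l = x ∷ ys , y , cong (x ∷_) e , cong suc l

Alternating-centred : ∀ n u₁ u′ → suc (length u′) ≡ n → All (InRange n) (u₁ ∷ u′) →
  Alternating (flips (suc n) true) (u₁ ∷ u′) → Oriented (flips n true) (compl n u₁) u₁ →
  Alternating true (0 ∷ revCompl n (u₁ ∷ u′) ++ u₁ ∷ u′ ++ [ suc (2 * n) ])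
Alternating-centred .(suc (length u′)) u₁ u′ refl inR au centre =
  Alternating-++ true (0 ∷ revCompl n u) u₁ (u′ ++ [ M ]) left right
  where
  n = suc (length u′)
  u = u₁ ∷ u′
  M = suc (2 * n)
  b = flips (suc n) true
  revAlt : Alternating false (revCompl n u)
  revAlt = subst (λ c → Alternating c (revCompl n u))
             (trans (cong₂ flips (length-map (compl n) u) (not-involutive b)) (flips-2n+1 n))
             (Alternating-reverse (not b) (map (compl n) u) (Alternating-compl n b u au (All.map (InRange⇒≤2n+1 n) inR)))
  start : Alternating true (0 ∷ revCompl n u)
  start with revCompl n u | revAlt | All-revCompl {Q = InRange n} n u (compl-InRange n) inR
  ... | [] | _ | _ = tt
  ... | _ ∷ _ | a | (p , _) ∷ _ = p , a
  left : Alternating true ((0 ∷ revCompl n u) ++ [ u₁ ])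
  left = subst (λ z → Alternating true ((0 ∷ z) ++ [ u₁ ])) (sym (revCompl-∷ n u₁ u′))
           (subst (Alternating true) (sym (cong (0 ∷_) (++-assoc (revCompl n u′) [ compl n u₁ ] [ u₁ ])))
             (Alternating-++ true (0 ∷ revCompl n u′) (compl n u₁) [ u₁ ]
               (subst (λ z → Alternating true (0 ∷ z)) (revCompl-∷ n u₁ u′) start)
               (subst (λ c → Alternating c (compl n u₁ ∷ [ u₁ ])) (cong (λ z → flips (suc z) true) (sym (length-revCompl n u′)))
                 (centre , tt))))
  right : Alternating (flips (length (0 ∷ revCompl n u)) true) (u₁ ∷ u′ ++ [ M ])
  right with ∷-∷ʳ-view u₁ u′
  ... | init , last , e , l =
    subst (λ c → Alternating c (u₁ ∷ u′ ++ [ M ])) (cong (λ z → flips (suc z) true) (sym (length-revCompl n u)))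
      (subst (λ z → Alternating b (z ++ [ M ])) (sym e)
        (subst (Alternating b) (sym (++-assoc init [ last ] [ M ]))
          (Alternating-++ b init last [ M ] (subst (Alternating b) e au)
            (subst (λ c → Oriented c last M) (sym (trans (cong (λ z → flips z b) l) (flips-2n+2 (length u′))))
              (s≤s (proj₂ (All.head (++⁻ʳ init (subst (All (InRange n)) e inR))))) , tt))))

Alternating-centred⁻ : ∀ n u₁ u′ → suc (length u′) ≡ n →
  Alternating true (0 ∷ revCompl n (u₁ ∷ u′) ++ u₁ ∷ u′ ++ [ suc (2 * n) ]) →
  Alternating (flips (suc n) true) (u₁ ∷ u′) × Oriented (flips n true) (compl n u₁) u₁
Alternating-centred⁻ .(suc (length u′)) u₁ u′ refl a
  with Alternating-split true (0 ∷ revCompl (suc (length u′)) (u₁ ∷ u′)) u₁ (u′ ++ [ suc (2 * suc (length u′)) ]) a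
... | left , right =
  Alternating-prefix b u [ M ] (subst (λ c → Alternating c (u ++ [ M ])) (cong (λ z → flips (suc z) true) (length-revCompl n u)) right) ,
  subst (λ c → Oriented c (compl n u₁) u₁) (cong (λ z → flips (suc z) true) (length-revCompl n u′))
    (proj₁ (proj₂ (Alternating-split true (0 ∷ revCompl n u′) (compl n u₁) [ u₁ ]
      (subst (Alternating true) (cong (0 ∷_) (++-assoc (revCompl n u′) [ compl n u₁ ] [ u₁ ]))
        (subst (λ z → Alternating true ((0 ∷ z) ++ [ u₁ ])) (revCompl-∷ n u₁ u′) left)))))
  where
  n = suc (length u′)
  u = u₁ ∷ u′
  M = suc (2 * n)
  b = flips (suc n) true

snake-SignedInRange : ∀ n π → map ∣_∣ π ↭ oneTo n → All (SignedInRange n) π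
snake-SignedInRange n π perm =
  map⁻ (All-resp-↭ (↭-sym perm) (subst (All (λ k → 1 ≤ k × k ≤ n)) (sym (oneTo-interval n))
    (All.map (λ { (p , q) → p , ≤-pred q }) (All-interval 1 n))))

tilde-InRange-All : ∀ n π → All (SignedInRange n) π → All (InRange n) (map (tilde n) π)
tilde-InRange-All n π inR = map⁺ (All.map (λ {x} → tilde-InRange n x) inR)

-- π₁ > 0 gives π̃₁ > n, which fixes how the centre of ψ(π) compares π̃₁ with its complement.
snake-alternating : ∀ n π → 1 ≤ n → IsSnake n π →
  Alternating true (0 ∷ revCompl n (halfOf n π) ++ halfOf n π ++ [ suc (2 * n) ])
snake-alternating n [] 1≤n (l , _) = ⊥-elim (<⇒≢ 1≤n l)
snake-alternating n (-[1+ _ ] ∷ _) _ (_ , _ , () , _)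
snake-alternating n (+ℤ a ∷ π′) 1≤n (l , perm , +<+ 0<a , ad) = byParity (odd n) refl
  where
  inR = snake-SignedInRange n (+ℤ a ∷ π′) perm
  t = map (tilde n) (+ℤ a ∷ π′)
  t₁ = n + a
  tInR = tilde-InRange-All n _ inR
  t≤ = All.map (InRange⇒≤2n+1 n) tInR
  altT : Alternating false t
  altT = AltDown⇒Alternating n (+ℤ a ∷ π′) inR ad
  n<t₁ : suc n ≤ t₁
  n<t₁ = subst (_≤ n + a) (+-comm n 1) (+-monoʳ-≤ n 0<a)
  compl-t₁<t₁ : compl n t₁ < t₁
  compl-t₁<t₁ = <-≤-trans (compl-high n n<t₁) n<t₁
  length-t′ : suc (length (map (tilde n) π′)) ≡ n
  length-t′ = trans (cong suc (length-map (tilde n) π′)) l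
  byParity : ∀ b → odd n ≡ b → Alternating true (0 ∷ revCompl n (complIf b n t) ++ complIf b n t ++ [ suc (2 * n) ])
  byParity true o with flips-odd n o
  ... | f₁ , f₂ =
    Alternating-centred n (compl n t₁) (map (compl n) (map (tilde n) π′))
      (trans (cong suc (length-map (compl n) (map (tilde n) π′))) length-t′)
      (map⁺ (All.map (compl-InRange n) tInR))
      (subst (λ c → Alternating c (map (compl n) t)) (sym f₁) (Alternating-compl n false t altT t≤))
      (subst (λ c → Oriented c (compl n (compl n t₁)) (compl n t₁)) (sym f₂)
        (subst (compl n t₁ <_) (sym (compl-involutive n (All.head t≤))) compl-t₁<t₁))
  byParity false o with flips-even n o
  ... | f₁ , f₂ =
    Alternating-centred n t₁ (map (tilde n) π′) length-t′ tInR
      (subst (λ c → Alternating c t) (sym f₁) altT)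
      (subst (λ c → Oriented c (compl n t₁) t₁) (sym f₂) compl-t₁<t₁)

centred⇒snakeShape : ∀ n u₁ u′ → All (_≤ suc (2 * n)) (u₁ ∷ u′) →
  Alternating (flips (suc n) true) (u₁ ∷ u′) → Oriented (flips n true) (compl n u₁) u₁ → ∀ b → odd n ≡ b →
  FirstPos (map (untilde n) (complIf b n (u₁ ∷ u′))) × AltDown (map (untilde n) (complIf b n (u₁ ∷ u′)))
centred⇒snakeShape n u₁ u′ u≤ alt centre true o with flips-odd n o
... | f₁ , f₂ =
  firstPos ,
  Alternating⇒AltDown n (map (compl n) (u₁ ∷ u′))
    (Alternating-compl⁻ n false (map (compl n) (u₁ ∷ u′))
      (subst (Alternating true) (sym (map-compl-involutive n (u₁ ∷ u′) u≤)) (subst (λ c → Alternating c (u₁ ∷ u′)) f₁ alt)))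
  where
  u₁<compl : u₁ < compl n u₁
  u₁<compl = subst (λ c → Oriented c (compl n u₁) u₁) f₂ centre
  n<compl : n < compl n u₁
  n<compl with u₁ <? suc n
  ... | yes p = compl-low n p
  ... | no p = ⊥-elim (<-asym u₁<compl (<-≤-trans (compl-high n (≮⇒≥ p)) (≮⇒≥ p)))
  firstPos : FirstPos (map (untilde n) (map (compl n) (u₁ ∷ u′)))
  firstPos rewrite untilde-high n (compl n u₁) n<compl = +<+ (m<n⇒0<n∸m n<compl)
centred⇒snakeShape n u₁ u′ u≤ alt centre false o with flips-even n o
... | f₁ , f₂ = firstPos , Alternating⇒AltDown n (u₁ ∷ u′) (subst (λ c → Alternating c (u₁ ∷ u′)) f₁ alt)
  where
  compl<u₁ : compl n u₁ < u₁
  compl<u₁ = subst (λ c → Oriented c (compl n u₁) u₁) f₂ centre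
  n<u₁ : n < u₁
  n<u₁ with u₁ ≤? n
  ... | yes p = ⊥-elim (<-asym compl<u₁ (<-≤-trans (s≤s p) (compl-low n (s≤s p))))
  ... | no p = ≰⇒> p
  firstPos : FirstPos (map (untilde n) (u₁ ∷ u′))
  firstPos rewrite untilde-high n u₁ n<u₁ = +<+ (m<n⇒0<n∸m n<u₁)

classify-UpDown : ∀ x y → UpDown (classify x y) → (x ≡ true × y ≡ true) ⊎ (x ≡ false × y ≡ false)
classify-UpDown true true up = inj₁ (refl , refl)
classify-UpDown false false down = inj₂ (refl , refl)

head-∷ʳ : ℕ → List ℕ → ℕ
head-∷ʳ M [] = M
head-∷ʳ M (r ∷ _) = r

tail-∷ʳ : ℕ → List ℕ → List ℕ
tail-∷ʳ M [] = []
tail-∷ʳ M (r ∷ R) = R ++ [ M ]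

∷ʳ-uncons : ∀ M R → R ++ [ M ] ≡ head-∷ʳ M R ∷ tail-∷ʳ M R
∷ʳ-uncons M [] = refl
∷ʳ-uncons M (r ∷ R) = refl

Zigzag⇒UpDown : ∀ σ M j → Zigzag (0 ∷ σ ++ [ M ]) → OccursOnce j σ → j < M → UpDown (proj₁ (fzAt σ j))
Zigzag⇒UpDown σ M j z (L , R , refl , j∉L , _) j<M with ∷-lastOr 0 L
... | A , eA = subst (λ s → UpDown (proj₁ s)) (sym (fzAt-split j L R j∉L))
                 (byNeighbours R (Zigzag-middle A (lastOr 0 L) j (head-∷ʳ M R) (tail-∷ʳ M R) (subst Zigzag around z)))
  where
  around : 0 ∷ (L ++ j ∷ R) ++ [ M ] ≡ A ++ lastOr 0 L ∷ j ∷ head-∷ʳ M R ∷ tail-∷ʳ M R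
  around = trans (cong (0 ∷_) (++-assoc L (j ∷ R) [ M ]))
             (trans (cong (_++ j ∷ (R ++ [ M ])) eA)
               (trans (++-assoc A [ lastOr 0 L ] (j ∷ R ++ [ M ])) (cong (λ z → A ++ lastOr 0 L ∷ j ∷ z) (∷ʳ-uncons M R))))
  byNeighbours : ∀ R → Extremum (lastOr 0 L) j (head-∷ʳ M R) → UpDown (classify (j <ᵇ lastOr 0 L) (ltNext j R))
  byNeighbours [] (inj₁ (p , _)) rewrite <ᵇ-true p = up
  byNeighbours [] (inj₂ (_ , q)) = ⊥-elim (<-asym q j<M)
  byNeighbours (r ∷ _) (inj₁ (p , q)) rewrite <ᵇ-true p | <ᵇ-true q = up
  byNeighbours (r ∷ _) (inj₂ (p , q)) rewrite <ᵇ-false (<⇒≤ p) | <ᵇ-false (<⇒≤ q) = down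

UpDown⇒Extremum : ∀ σ M j → 0 < j → j < M → OccursOnce j σ → UpDown (proj₁ (fzAt σ j)) →
  ∀ A a c B → 0 ∷ σ ++ [ M ] ≡ A ++ a ∷ j ∷ c ∷ B → Extremum a j c
UpDown⇒Extremum σ M j 0<j j<M (L , R , refl , j∉L , j∉R) ud A a c B e
  with ++≡++∷-cases (A ++ [ a ]) (j ∷ c ∷ B) (0 ∷ L) (R ++ [ M ]) j
         (trans (++-assoc A [ a ] (j ∷ c ∷ B)) (trans (sym e) (cong (0 ∷_) (++-assoc L (j ∷ R) [ M ]))))
... | inj₁ (A₂ , _ , e₂) =
  ⊥-elim (All.head (++⁻ʳ A₂ (subst (All (_≢ j)) e₂ (++⁺ j∉R ((λ q → <-irrefl (sym q) j<M) ∷ [])))) refl)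
... | inj₂ (p ∷ P₂ , e₁ , e₂) =
  ⊥-elim (All.head (++⁻ʳ (A ++ [ a ]) (subst (All (_≢ j)) e₁ ((λ q → <-irrefl q 0<j) ∷ j∉L))) (sym (∷-injectiveˡ e₂)))
... | inj₂ ([] , e₁ , e₂) = byNeighbours R j∉R ud′ (∷-injectiveʳ e₂)
  where
  a≡ : lastOr 0 L ≡ a
  a≡ = lastOr-∷≡ 0 L A a [] (trans e₁ (++-identityʳ (A ++ [ a ])))
  ud′ : UpDown (classify (j <ᵇ a) (ltNext j R))
  ud′ = subst (λ z → UpDown (classify (j <ᵇ z) (ltNext j R))) a≡ (subst (λ s → UpDown (proj₁ s)) (fzAt-split j L R j∉L) ud)
  a≢j : a ≢ j
  a≢j = subst (_≢ j) a≡ (lastOr-All 0 L ((λ q → <-irrefl q 0<j) ∷ j∉L))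
  byNeighbours : ∀ R → All (_≢ j) R → UpDown (classify (j <ᵇ a) (ltNext j R)) → c ∷ B ≡ R ++ [ M ] → Extremum a j c
  byNeighbours [] _ ud″ e′ with classify-UpDown (j <ᵇ a) true ud″
  ... | inj₁ (x , _) = inj₁ (<ᵇ-true⇒< x , subst (j <_) (sym (∷-injectiveˡ e′)) j<M)
  ... | inj₂ (_ , ())
  byNeighbours (r ∷ _) (r≢j ∷ _) ud″ e′ with classify-UpDown (j <ᵇ a) (j <ᵇ r) ud″
  ... | inj₁ (x , y) = inj₁ (<ᵇ-true⇒< x , subst (j <_) (sym (∷-injectiveˡ e′)) (<ᵇ-true⇒< y))
  ... | inj₂ (x , y) = inj₂ (≤∧≢⇒< (<ᵇ-false⇒≥ x) a≢j , subst (_< j) (sym (∷-injectiveˡ e′)) (≤∧≢⇒< (<ᵇ-false⇒≥ y) r≢j))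

-- The map into labeled ballot paths, and its injectivity

record Framed (n : ℕ) (σ : List ℕ) : Set where
  field
    inRange : All (InRange n) σ
    occursOnce : ∀ j → 1 ≤ j → j ≤ n → OccursOnce j σ
    symmetric : revCompl n σ ≡ σ

n<2n+1 : ∀ n → n < suc (2 * n)
n<2n+1 n = s≤s (m≤m+n n (n + 0))

framedWord-symmetric : ∀ n σ → revCompl n σ ≡ σ → revCompl n (0 ∷ σ ++ [ suc (2 * n) ]) ≡ 0 ∷ σ ++ [ suc (2 * n) ]
framedWord-symmetric n σ s = begin
  revCompl n (0 ∷ σ ++ [ M ])            ≡⟨ revCompl-∷ n 0 (σ ++ [ M ]) ⟩
  revCompl n (σ ++ [ M ]) ++ [ M ]       ≡⟨ cong (_++ [ M ]) (revCompl-++ n σ [ M ]) ⟩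
  (compl n M ∷ revCompl n σ) ++ [ M ]    ≡⟨ cong (λ z → (z ∷ revCompl n σ) ++ [ M ]) (n∸n≡0 M) ⟩
  0 ∷ revCompl n σ ++ [ M ]              ≡⟨ cong (λ z → 0 ∷ z ++ [ M ]) s ⟩
  0 ∷ σ ++ [ M ]                         ∎
  where
  open ≡-Reasoning
  M = suc (2 * n)

All-oneTo : ∀ n → All (λ j → 1 ≤ j × j ≤ n) (oneTo n)
All-oneTo n = subst (All _) (sym (oneTo-interval n)) (All.map (λ { (p , q) → p , ≤-pred q }) (All-interval 1 n))

length-oneTo : ∀ n → length (oneTo n) ≡ n
length-oneTo n = trans (length-map suc (upTo n)) (length-upTo n)

sweep-framed : ∀ n σ → Framed n σ →
  Swept n (0 ∷ σ ++ [ suc (2 * n) ]) 1 ([ 0 ] ∷ []) (fzSteps σ (oneTo n)) (fzLabels σ (oneTo n))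
sweep-framed n σ f =
  subst (λ I → Swept n (0 ∷ σ ++ [ M ]) 1 ([ 0 ] ∷ []) (fzSteps σ I) (fzLabels σ I)) (sym (oneTo-interval n))
    (sweep n σ M n 1 (([ 0 ] , σ ++ [ M ]) ∷ []) refl (s≤s z≤n) (n<2n+1 n)
      ((tt , s≤s z≤n ∷ [] , NonEmpty-++ʳ σ tt , ++⁺ (All.map proj₁ inRange) (s≤s z≤n ∷ [])) ∷ [])
      (cong (0 ∷_) (++-identityʳ (σ ++ [ M ]))) occursOnce)
  where
  open Framed f
  M = suc (2 * n)

framed-word-determined : ∀ n σ → Framed n σ →
  0 ∷ σ ++ [ suc (2 * n) ] ≡ symmetricWord n (insertLows 1 ([ 0 ] ∷ []) (fzSteps σ (oneTo n)) (fzLabels σ (oneTo n)))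
framed-word-determined n σ f =
  trans (sym unsegment-≡)
    (trans (symmetricWord-determined n segs segmentation
              (trans (cong (revCompl n) unsegment-≡)
                (trans (framedWord-symmetric n σ (Framed.symmetric f)) (sym unsegment-≡))))
      (cong (symmetricWord n) lows-≡))
  where open Swept (sweep-framed n σ f)

fzSteps-UpDown : ∀ n σ → Framed n σ → Zigzag (0 ∷ σ ++ [ suc (2 * n) ]) → All UpDown (fzSteps σ (oneTo n))
fzSteps-UpDown n σ f z =
  map⁺ (All.map (λ { {j} (p , q) → Zigzag⇒UpDown σ _ j z (Framed.occursOnce f j p q) (≤-<-trans q (n<2n+1 n)) })
                (All-oneTo n))

occurrences-untilde : ∀ b n t k → k < n → All (_≤ suc (2 * n)) t →
  occurrences (n ∸ k) (revCompl n (complIf b n t) ++ complIf b n t) ≡ occurrences (suc k) (map ∣_∣ (map (untilde n) t))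
occurrences-untilde b n t k k<n t≤ = begin
  occurrences j (revCompl n u ++ u)                  ≡⟨ countᵇ-++ _ (revCompl n u) u ⟩
  occurrences j (revCompl n u) + occurrences j u     ≡⟨ cong (_+ occurrences j u) (countᵇ-reverse _ (map (compl n) u)) ⟩
  occurrences j (map (compl n) u) + occurrences j u  ≡⟨ bothHalves b ⟩
  occurrences j t + occurrences j (map (compl n) t)  ≡⟨ cong (occurrences j t +_) (countᵇ-map _ (compl n) t) ⟩
  occurrences j t + countᵇ (λ v → compl n v ≡ᵇ j) t ≡⟨ countᵇ-sum _ _ _ t (All.universal (λ v → indicator-untilde n k v k<n) t) ⟩
  countᵇ (λ v → ∣ untilde n v ∣ ≡ᵇ suc k) t         ≡⟨ trans (countᵇ-map _ ∣_∣ (map (untilde n) t)) (countᵇ-map _ (untilde n) t) ⟨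
  occurrences (suc k) (map ∣_∣ (map (untilde n) t))  ∎
  where
  open ≡-Reasoning
  j = n ∸ k
  u = complIf b n t
  bothHalves : ∀ b → occurrences j (map (compl n) (complIf b n t)) + occurrences j (complIf b n t)
                     ≡ occurrences j t + occurrences j (map (compl n) t)
  bothHalves true = cong (λ z → occurrences j z + occurrences j (map (compl n) t)) (map-compl-involutive n t t≤)
  bothHalves false = +-comm (occurrences j (map (compl n) t)) (occurrences j t)

map-untilde-tilde : ∀ n π → All (SignedInRange n) π → map (untilde n) (map (tilde n) π) ≡ π
map-untilde-tilde n π inR = trans (sym (map-∘ π)) (map-id-local (All.map (λ {x} → untilde-tilde n x) inR))

snake-framed : ∀ n π → IsSnake n π → Framed n (psi n π)
snake-framed n π (_ , perm , _ , _) = record { inRange = inRange ; occursOnce = occursOnce ; symmetric = symmetric }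
  where
  open ≡-Reasoning
  inR = snake-SignedInRange n π perm
  t = map (tilde n) π
  tInR = tilde-InRange-All n π inR
  t≤ = All.map (InRange⇒≤2n+1 n) tInR
  u = halfOf n π
  uInR = complIf-InRange (odd n) n t tInR
  halves = psi-halves n π t≤
  inRange : All (InRange n) (psi n π)
  inRange = subst (All (InRange n)) (sym halves) (++⁺ (All-revCompl n u (compl-InRange n) uInR) uInR)
  symmetric : revCompl n (psi n π) ≡ psi n π
  symmetric = begin
    revCompl n (psi n π)                   ≡⟨ cong (revCompl n) halves ⟩
    revCompl n (revCompl n u ++ u)         ≡⟨ revCompl-++ n (revCompl n u) u ⟩
    revCompl n u ++ revCompl n (revCompl n u) ≡⟨ cong (revCompl n u ++_) (revCompl-involutive n u (All.map (InRange⇒≤2n+1 n) uInR)) ⟩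
    revCompl n u ++ u                      ≡⟨ halves ⟨
    psi n π                                ∎
  occursOnce : ∀ j → 1 ≤ j → j ≤ n → OccursOnce j (psi n π)
  occursOnce j 1≤j j≤n = occurrences-one j (psi n π) (begin
    occurrences j (psi n π)                           ≡⟨ cong (occurrences j) halves ⟩
    occurrences j (revCompl n u ++ u)                 ≡⟨ cong (λ z → occurrences z (revCompl n u ++ u)) (m∸[m∸n]≡n j≤n) ⟨
    occurrences (n ∸ k) (revCompl n u ++ u)           ≡⟨ occurrences-untilde (odd n) n t k k<n t≤ ⟩
    occurrences (suc k) (map ∣_∣ (map (untilde n) t)) ≡⟨ cong (λ z → occurrences (suc k) (map ∣_∣ z)) (map-untilde-tilde n π inR) ⟩
    occurrences (suc k) (map ∣_∣ π)                   ≡⟨ countᵇ-↭ _ perm ⟩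
    occurrences (suc k) (oneTo n)                     ≡⟨ cong (occurrences (suc k)) (oneTo-interval n) ⟩
    occurrences (suc k) (interval 1 n)                ≡⟨ occurrences-interval (suc k) 1 n (s≤s z≤n) (s≤s k<n) ⟩
    1                                                 ∎)
    where
    k = n ∸ j
    k<n : k < n
    k<n = ∸-monoʳ-< {n} {j} {0} 1≤j j≤n

snake-zigzag : ∀ n π → 1 ≤ n → IsSnake n π → Zigzag (0 ∷ psi n π ++ [ suc (2 * n) ])
snake-zigzag n π 1≤n sn@(_ , perm , _ , _) =
  Alternating⇒Zigzag true _
    (subst (λ z → Alternating true (0 ∷ z ++ [ suc (2 * n) ])) (sym (psi-halves n π t≤))
      (subst (Alternating true) (cong (0 ∷_) (sym (++-assoc (revCompl n (halfOf n π)) (halfOf n π) [ suc (2 * n) ])))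
        (snake-alternating n π 1≤n sn)))
  where t≤ = All.map (InRange⇒≤2n+1 n) (tilde-InRange-All n π (snake-SignedInRange n π perm))

Φ-IsLBP : ∀ n π → 1 ≤ n → IsSnake n π → IsLBP n (Φ n π)
Φ-IsLBP n π 1≤n sn =
  trans (length-map _ (oneTo n)) (length-oneTo n) ,
  AdmissiblePath⇒LB 1 ([ 0 ] ∷ []) 0 _ _ refl (fzSteps-UpDown n σ f (snake-zigzag n π 1≤n sn))
    (Swept.admissible (sweep-framed n σ f))
  where
  σ = psi n π
  f = snake-framed n π sn

++-cancelˡ-length : ∀ {A : Set} (X X′ Y Y′ : List A) → length X ≡ length X′ → X ++ Y ≡ X′ ++ Y′ → Y ≡ Y′
++-cancelˡ-length [] [] Y Y′ _ e = e
++-cancelˡ-length (x ∷ X) (x′ ∷ X′) Y Y′ l e = ++-cancelˡ-length X X′ Y Y′ (suc-injective l) (∷-injectiveʳ e)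

psi-injective : ∀ n π π′ → IsSnake n π → IsSnake n π′ → psi n π ≡ psi n π′ → π ≡ π′
psi-injective n π π′ (l , perm , _) (l′ , perm′ , _) e = begin
  π                                       ≡⟨ map-untilde-tilde n π inR ⟨
  map (untilde n) (map (tilde n) π)       ≡⟨ cong (map (untilde n)) t≡ ⟩
  map (untilde n) (map (tilde n) π′)      ≡⟨ map-untilde-tilde n π′ inR′ ⟩
  π′                                      ∎
  where
  open ≡-Reasoning
  inR = snake-SignedInRange n π perm
  inR′ = snake-SignedInRange n π′ perm′
  t≤ = All.map (InRange⇒≤2n+1 n) (tilde-InRange-All n π inR)
  t≤′ = All.map (InRange⇒≤2n+1 n) (tilde-InRange-All n π′ inR′)
  length-half : ∀ ρ → length ρ ≡ n → length (revCompl n (halfOf n ρ)) ≡ n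
  length-half ρ lρ = trans (length-revCompl n (halfOf n ρ)) (trans (length-complIf (odd n) n (map (tilde n) ρ)) (trans (length-map (tilde n) ρ) lρ))
  u≡ : halfOf n π ≡ halfOf n π′
  u≡ = ++-cancelˡ-length _ _ _ _ (trans (length-half π l) (sym (length-half π′ l′)))
         (trans (sym (psi-halves n π t≤)) (trans e (psi-halves n π′ t≤′)))
  t≡ : map (tilde n) π ≡ map (tilde n) π′
  t≡ = trans (sym (complIf-involutive (odd n) n _ t≤)) (trans (cong (complIf (odd n) n) u≡) (complIf-involutive (odd n) n _ t≤′))

Φ-injective : ∀ n π π′ → IsSnake n π → IsSnake n π′ → Φ n π ≡ Φ n π′ → π ≡ π′
Φ-injective n π π′ sn sn′ e = psi-injective n π π′ sn sn′ (∷ʳ-injectiveˡ (psi n π) (psi n π′) (∷-injectiveʳ words≡))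
  where
  words≡ : 0 ∷ psi n π ++ [ suc (2 * n) ] ≡ 0 ∷ psi n π′ ++ [ suc (2 * n) ]
  words≡ = trans (framed-word-determined n (psi n π) (snake-framed n π sn))
             (trans (cong (λ x → symmetricWord n (insertLows 1 ([ 0 ] ∷ []) (proj₁ x) (proj₂ x))) e)
               (sym (framed-word-determined n (psi n π′) (snake-framed n π′ sn′))))

-- Surjectivity

HeadZero : List (List ℕ) → Set
HeadZero ((zero ∷ _) ∷ _) = ⊤
HeadZero _ = ⊥

insertLow-HeadZero : ∀ i Bs m w → HeadZero Bs → HeadZero (insertLow Bs m w i)
insertLow-HeadZero i ((zero ∷ B) ∷ Bs) m (suc w) _ = tt
insertLow-HeadZero i ((zero ∷ B) ∷ Bs) U zero _ = tt
insertLow-HeadZero i ((zero ∷ B) ∷ Bs) H zero _ = tt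
insertLow-HeadZero i ((zero ∷ B) ∷ []) D zero _ = tt
insertLow-HeadZero i ((zero ∷ B) ∷ _ ∷ _) D zero _ = tt
insertLow-HeadZero i ((zero ∷ B) ∷ []) H̃ zero _ = tt
insertLow-HeadZero i ((zero ∷ B) ∷ _ ∷ _) H̃ zero _ = tt

concat-insertLow : ∀ i Bs m w → Admissible m w (length Bs) → concat (insertLow Bs m w i) ↭ i ∷ concat Bs
concat-insertLow i [] m w a = ⊥-elim (¬Admissible-0 m a)
concat-insertLow i (B ∷ Bs) m (suc w) a =
  ↭-trans (++⁺ˡ B (concat-insertLow i Bs m w (Admissible-pred m a))) (shift i B (concat Bs))
concat-insertLow i (B ∷ Bs) U zero _ = shift i B (concat Bs)
concat-insertLow i (B ∷ Bs) H zero _ = ↭-trans (↭-reflexive (++-assoc B [ i ] (concat Bs))) (shift i B (concat Bs))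
concat-insertLow i (B ∷ B′ ∷ Bs) D zero _ = ↭-trans (↭-reflexive (++-assoc B (i ∷ B′) (concat Bs))) (shift i B (B′ ++ concat Bs))
concat-insertLow i (B ∷ B′ ∷ Bs) H̃ zero _ = shift i B (B′ ++ concat Bs)
concat-insertLow i (B ∷ []) D zero (s≤s ())
concat-insertLow i (B ∷ []) H̃ zero (s≤s ())

record LowRuns (i : ℕ) (Bs : List (List ℕ)) : Set where
  field
    nonEmpty : All NonEmpty Bs
    bounded : All (All (_< i)) Bs
    headZero : HeadZero Bs
    permutation : concat Bs ↭ interval 0 i

insertLows-LowRuns : ∀ i Bs P W → AdmissiblePath i Bs P W → LowRuns i Bs → LowRuns (i + length P) (insertLows i Bs P W)
insertLows-LowRuns i Bs [] [] _ inv = subst (λ k → LowRuns k Bs) (sym (+-identityʳ i)) inv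
insertLows-LowRuns i Bs (m ∷ P) (w ∷ W) (a , as) inv =
  subst (λ k → LowRuns k (insertLows i Bs (m ∷ P) (w ∷ W))) (sym (+-suc i (length P)))
    (insertLows-LowRuns (suc i) (insertLow Bs m w i) P W as record
      { nonEmpty = proj₁ runs
      ; bounded = proj₂ runs
      ; headZero = insertLow-HeadZero i Bs m w headZero
      ; permutation = ↭-trans (concat-insertLow i Bs m w a)
                        (↭-trans (prep i permutation) (↭-trans (∷↭∷ʳ i (interval 0 i)) (↭-reflexive (sym (interval-∷ʳ 0 i)))))
      })
  where
  open LowRuns inv
  runs = insertLow-lowRuns i Bs m w nonEmpty bounded a

occurrences-unsegment : ∀ {i} j Ds → Segmentation i Ds → j < i → occurrences j (unsegment Ds) ≡ occurrences j (concat (lows Ds))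
occurrences-unsegment j [] [] _ = refl
occurrences-unsegment j ((B , R) ∷ Ds) ((_ , _ , _ , hi) ∷ v) j<i = begin
  occurrences j (B ++ R ++ unsegment Ds)                       ≡⟨ countᵇ-++ _ B (R ++ unsegment Ds) ⟩
  occurrences j B + occurrences j (R ++ unsegment Ds)          ≡⟨ cong (occurrences j B +_) (countᵇ-++ _ R (unsegment Ds)) ⟩
  occurrences j B + (occurrences j R + occurrences j (unsegment Ds))
    ≡⟨ cong₂ (λ x y → occurrences j B + (x + y))
             (occurrences-absent j R (All.map (λ q e → <-irrefl (sym e) (<-≤-trans j<i q)) hi))
             (occurrences-unsegment j Ds v j<i) ⟩
  occurrences j B + occurrences j (concat (lows Ds))           ≡⟨ countᵇ-++ _ B (concat (lows Ds)) ⟨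
  occurrences j (B ++ concat (lows Ds))                        ∎
  where open ≡-Reasoning

length-unsegment : ∀ Ds → length (unsegment Ds) ≡ length (concat (lows Ds)) + length (concat (map proj₂ Ds))
length-unsegment [] = refl
length-unsegment ((B , R) ∷ Ds) = begin
  length (B ++ R ++ unsegment Ds)                     ≡⟨ length-++ B ⟩
  length B + length (R ++ unsegment Ds)               ≡⟨ cong (length B +_) (trans (length-++ R) (cong (length R +_) (length-unsegment Ds))) ⟩
  length B + (length R + (a + b))                     ≡⟨ +-assoc (length B) (length R) _ ⟨
  (length B + length R) + (a + b)                     ≡⟨ +-interchange (length B) a (length R) b ⟨
  (length B + a) + (length R + b)                     ≡⟨ cong₂ _+_ (length-++ B) (length-++ R) ⟨
  length (B ++ concat (lows Ds)) + length (R ++ concat (map proj₂ Ds)) ∎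
  where
  open ≡-Reasoning
  a = length (concat (lows Ds))
  b = length (concat (map proj₂ Ds))

length-concat-↭ : ∀ {xss yss : List (List ℕ)} → xss ↭ yss → length (concat xss) ≡ length (concat yss)
length-concat-↭ p = ↭-length (concat-↭ p)
  where
  concat-↭ : ∀ {xss yss : List (List ℕ)} → xss ↭ yss → concat xss ↭ concat yss
  concat-↭ ↭.refl = ↭-refl
  concat-↭ (↭.prep xs p) = ++⁺ˡ xs (concat-↭ p)
  concat-↭ (↭.swap xs ys p) = ↭-trans (shifts xs ys) (++⁺ˡ ys (++⁺ˡ xs (concat-↭ p)))
  concat-↭ (↭.trans p q) = ↭-trans (concat-↭ p) (concat-↭ q)

length-interval : ∀ a k → length (interval a k) ≡ k
length-interval a zero = refl
length-interval a (suc k) = cong suc (length-interval (suc a) k)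

length-concat-revCompl : ∀ n (Z : List (List ℕ)) → length (concat (map (revCompl n) Z)) ≡ length (concat Z)
length-concat-revCompl n [] = refl
length-concat-revCompl n (z ∷ Z) =
  trans (length-++ (revCompl n z)) (trans (cong₂ _+_ (length-revCompl n z) (length-concat-revCompl n Z)) (sym (length-++ z)))

All-unsegment : ∀ {P : ℕ → Set} Ds → All (λ s → All P (proj₁ s) × All P (proj₂ s)) Ds → All P (unsegment Ds)
All-unsegment [] [] = []
All-unsegment ((B , R) ∷ Ds) ((pB , pR) ∷ ps) = ++⁺ pB (++⁺ pR (All-unsegment Ds ps))

occurrences-symmetricWord : ∀ n Fb j → LowRuns (suc n) Fb → j < suc n → occurrences j (symmetricWord n Fb) ≡ 1
occurrences-symmetricWord n Fb j inv j<1+n =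
  trans (occurrences-unsegment j (symmetricSegs n Fb) (symmetricSegs-segmentation n Fb nonEmpty bounded) j<1+n)
    (trans (cong (λ z → occurrences j (concat z)) (lows-symmetricSegs n Fb))
      (trans (countᵇ-↭ _ permutation) (occurrences-interval j 0 (suc n) z≤n j<1+n)))
  where open LowRuns inv

length-symmetricWord : ∀ n Fb → LowRuns (suc n) Fb → length (symmetricWord n Fb) ≡ suc n + suc n
length-symmetricWord n Fb inv =
  trans (length-unsegment (symmetricSegs n Fb))
    (cong₂ _+_ (trans (cong (length ∘ concat) (lows-symmetricSegs n Fb)) lowsLength)
               (trans (cong (length ∘ concat) (map-proj₂-zip Fb _ (length-symmetricHighs n Fb)))
                 (trans (length-concat-↭ (↭-reverse (map (revCompl n) Fb)))
                   (trans (length-concat-revCompl n Fb) lowsLength))))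
  where
  open LowRuns inv
  lowsLength : length (concat Fb) ≡ suc n
  lowsLength = trans (↭-length permutation) (length-interval 0 (suc n))

symmetricWord-≤2n+1 : ∀ n Fb → All (All (_< suc n)) Fb → All (_≤ suc (2 * n)) (symmetricWord n Fb)
symmetricWord-≤2n+1 n Fb los =
  All-unsegment (symmetricSegs n Fb)
    (All-zip (All.map (All.map (λ q → ≤-trans (<⇒≤ q) (s≤s (m≤m+n n (n + 0))))) los)
             (All-reverse (map (revCompl n) Fb)
               (map⁺ (All.universal (λ B → All-revCompl {Q = _≤ suc (2 * n)} n B (λ {v} _ → m∸n≤m (suc (2 * n)) v)
                                                (All.universal (λ _ → tt) B)) Fb))))

symmetricWord-head : ∀ n Bs → HeadZero Bs → Σ (List ℕ) λ zs → symmetricWord n Bs ≡ 0 ∷ zs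
symmetricWord-head n ((zero ∷ B) ∷ Bs) _ =
  nonEmpty (reverse (map (revCompl n) Bs)) (unfold-reverse (revCompl n (zero ∷ B)) (map (revCompl n) Bs))
  where
  nonEmpty : ∀ Rs → reverse (map (revCompl n) ((zero ∷ B) ∷ Bs)) ≡ Rs ∷ʳ revCompl n (zero ∷ B) →
    Σ (List ℕ) λ zs → symmetricWord n ((zero ∷ B) ∷ Bs) ≡ 0 ∷ zs
  nonEmpty [] e = _ , cong (λ z → unsegment (zip ((zero ∷ B) ∷ Bs) z)) e
  nonEmpty (R ∷ Rs) e = _ , cong (λ z → unsegment (zip ((zero ∷ B) ∷ Bs) z)) e

-- The complement of 0 is 2n + 1, so a symmetric word starting with 0 ends with 2n + 1.
symmetric-unframe : ∀ n zs → revCompl n (0 ∷ zs) ≡ 0 ∷ zs →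
  Σ (List ℕ) λ σ → (zs ≡ σ ++ [ suc (2 * n) ]) × (revCompl n σ ≡ σ)
symmetric-unframe n zs e with revCompl n zs in eq
... | [] with () ← ∷-injectiveˡ (trans (sym (cong (_++ [ compl n 0 ]) eq)) (trans (sym (revCompl-∷ n 0 zs)) e))
... | h ∷ rest = rest , zs≡ , ∷-injectiveʳ (trans (sym revCompl-zs) (trans eq (cong (_∷ rest) (∷-injectiveˡ e′))))
  where
  e′ : h ∷ rest ++ [ suc (2 * n) ] ≡ 0 ∷ zs
  e′ = trans (sym (cong (_++ [ compl n 0 ]) eq)) (trans (sym (revCompl-∷ n 0 zs)) e)
  zs≡ : zs ≡ rest ++ [ suc (2 * n) ]
  zs≡ = sym (∷-injectiveʳ e′)
  revCompl-zs : revCompl n zs ≡ 0 ∷ revCompl n rest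
  revCompl-zs = trans (cong (revCompl n) zs≡)
                  (trans (revCompl-++ n rest [ suc (2 * n) ]) (cong (_∷ revCompl n rest) (n∸n≡0 (suc (2 * n)))))

occurrences-revCompl : ∀ n j l → j ≤ suc (2 * n) → All (_≤ suc (2 * n)) l →
  occurrences (compl n j) (revCompl n l) ≡ occurrences j l
occurrences-revCompl n j l j≤ l≤ =
  trans (countᵇ-reverse _ (map (compl n) l))
    (trans (countᵇ-map _ (compl n) l)
      (countᵇ-cong _ _ l (All.map (λ {v} v≤ → ≡ᵇ-cong
        (λ e → trans (sym (compl-involutive n v≤)) (trans (cong (compl n) e) (compl-involutive n j≤)))
        (cong (compl n))) l≤)))

record Unframed (n : ℕ) (Bs : List (List ℕ)) : Set where
  field
    σ : List ℕ
    word≡ : symmetricWord n Bs ≡ 0 ∷ σ ++ [ suc (2 * n) ]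
    framed : Framed n σ
    length-σ : length σ ≡ n + n

-- The framing letters 0 and 2n + 1 each occur once in the framed word, so not in σ.
framed-of-occurrences : ∀ n σ → revCompl n σ ≡ σ → All (_≤ suc (2 * n)) (0 ∷ σ ++ [ suc (2 * n) ]) →
  (∀ j → j < suc n → occurrences j (0 ∷ σ ++ [ suc (2 * n) ]) ≡ 1) → Framed n σ
framed-of-occurrences n σ σ-sym ys≤ ys-once =
  record { inRange = inRange ; occursOnce = occursOnce ; symmetric = σ-sym }
  where
  open ≡-Reasoning
  M = suc (2 * n)
  ys = 0 ∷ σ ++ [ M ]
  occurrences-ys : ∀ j → occurrences j ys ≡ indicator (0 ≡ᵇ j) + (occurrences j σ + (indicator (M ≡ᵇ j) + 0))
  occurrences-ys j = cong (indicator (0 ≡ᵇ j) +_) (countᵇ-++ _ σ [ M ])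
  0∉σ : occurrences 0 σ ≡ 0
  0∉σ = trans (sym (+-identityʳ _)) (suc-injective (trans (sym (occurrences-ys 0)) (ys-once 0 (s≤s z≤n))))
  M∉σ : occurrences M σ ≡ 0
  M∉σ = +-cancelʳ-≡ 1 (occurrences M σ) 0 (begin
    occurrences M σ + 1                                  ≡⟨ cong (λ b → occurrences M σ + (indicator b + 0)) (≡ᵇ-refl M) ⟨
    occurrences M σ + (indicator (M ≡ᵇ M) + 0)           ≡⟨ occurrences-ys M ⟨
    occurrences M ys                                     ≡⟨ cong (occurrences M) (framedWord-symmetric n σ σ-sym) ⟨
    occurrences (compl n 0) (revCompl n ys)              ≡⟨ occurrences-revCompl n 0 ys z≤n ys≤ ⟩
    occurrences 0 ys                                     ≡⟨ ys-once 0 (s≤s z≤n) ⟩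
    1                                                    ∎)
  inRange : All (InRange n) σ
  inRange = All.map toRange (All.zip (All.zip (occurrences-zero 0 σ 0∉σ , occurrences-zero M σ M∉σ) , ++⁻ˡ σ (All.tail ys≤)))
    where
    toRange : ∀ {v} → (v ≢ 0 × v ≢ M) × v ≤ M → InRange n v
    toRange {zero} ((v≢0 , _) , _) = ⊥-elim (v≢0 refl)
    toRange {suc v} ((_ , v≢M) , v≤M) = s≤s z≤n , ≤-pred (≤∧≢⇒< v≤M v≢M)
  occursOnce : ∀ j → 1 ≤ j → j ≤ n → OccursOnce j σ
  occursOnce (suc j) _ j≤n = occurrences-one (suc j) σ (begin
    occurrences (suc j) σ                                     ≡⟨ +-identityʳ _ ⟨
    occurrences (suc j) σ + 0                                 ≡⟨ cong (λ b → occurrences (suc j) σ + (indicator b + 0))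
                                                                      (≡ᵇ-false (λ e → <-irrefl (sym e) (≤-<-trans j≤n (n<2n+1 n)))) ⟨
    occurrences (suc j) σ + (indicator (M ≡ᵇ suc j) + 0)      ≡⟨ occurrences-ys (suc j) ⟨
    occurrences (suc j) ys                                    ≡⟨ ys-once (suc j) (s≤s j≤n) ⟩
    1                                                         ∎)

unframe : ∀ n Fb → LowRuns (suc n) Fb → Unframed n Fb
unframe n Fb inv with symmetricWord-head n Fb (LowRuns.headZero inv)
... | zs , ys≡
  with symmetric-unframe n zs (trans (cong (revCompl n) (sym ys≡)) (trans (symmetricWord-symmetric n Fb (LowRuns.bounded inv)) ys≡))
... | σ , refl , σ-sym = record
  { σ = σ
  ; word≡ = ys≡
  ; framed = framed-of-occurrences n σ σ-sym
      (subst (All (_≤ suc (2 * n))) ys≡ (symmetricWord-≤2n+1 n Fb (LowRuns.bounded inv)))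
      (λ j p → trans (cong (occurrences j) (sym ys≡)) (occurrences-symmetricWord n Fb j inv p))
  ; length-σ = +-cancelʳ-≡ 1 (length σ) (n + n)
      (trans (sym (length-++ σ)) (trans (suc-injective length-ys) (trans (+-suc n n) (+-comm 1 (n + n)))))
  }
  where
  length-ys : length (0 ∷ σ ++ [ suc (2 * n) ]) ≡ suc n + suc n
  length-ys = trans (cong length (sym ys≡)) (length-symmetricWord n Fb inv)

revCompl-middle : ∀ n A a x c B → revCompl n (A ++ a ∷ x ∷ c ∷ B) ≡ revCompl n B ++ compl n c ∷ compl n x ∷ compl n a ∷ revCompl n A
revCompl-middle n A a x c B = begin
  revCompl n (A ++ a ∷ x ∷ c ∷ B)                                        ≡⟨ revCompl-++ n A (a ∷ x ∷ c ∷ B) ⟩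
  revCompl n (a ∷ x ∷ c ∷ B) ++ revCompl n A                             ≡⟨ cong (_++ revCompl n A) three ⟩
  (revCompl n B ++ compl n c ∷ compl n x ∷ compl n a ∷ []) ++ revCompl n A ≡⟨ ++-assoc (revCompl n B) _ (revCompl n A) ⟩
  revCompl n B ++ compl n c ∷ compl n x ∷ compl n a ∷ revCompl n A       ∎
  where
  open ≡-Reasoning
  three : revCompl n (a ∷ x ∷ c ∷ B) ≡ revCompl n B ++ compl n c ∷ compl n x ∷ compl n a ∷ []
  three = begin
    revCompl n (a ∷ x ∷ c ∷ B)                                       ≡⟨ revCompl-∷ n a (x ∷ c ∷ B) ⟩
    revCompl n (x ∷ c ∷ B) ∷ʳ compl n a                              ≡⟨ cong (_∷ʳ compl n a) (revCompl-∷ n x (c ∷ B)) ⟩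
    (revCompl n (c ∷ B) ∷ʳ compl n x) ∷ʳ compl n a                   ≡⟨ cong (λ z → (z ∷ʳ compl n x) ∷ʳ compl n a) (revCompl-∷ n c B) ⟩
    ((revCompl n B ∷ʳ compl n c) ∷ʳ compl n x) ∷ʳ compl n a          ≡⟨ ++-assoc (revCompl n B ∷ʳ compl n c) [ compl n x ] [ compl n a ] ⟩
    (revCompl n B ∷ʳ compl n c) ++ compl n x ∷ compl n a ∷ []        ≡⟨ ++-assoc (revCompl n B) [ compl n c ] _ ⟩
    revCompl n B ++ compl n c ∷ compl n x ∷ compl n a ∷ []           ∎

∷ʳ-inner : ∀ {P : ℕ → Set} σ A {M x c B} → All P σ → σ ++ [ M ] ≡ A ++ x ∷ c ∷ B → P x
∷ʳ-inner [] [] _ ()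
∷ʳ-inner [] (_ ∷ []) _ ()
∷ʳ-inner [] (_ ∷ _ ∷ _) _ ()
∷ʳ-inner (s ∷ σ) [] (p ∷ _) e = subst _ (∷-injectiveˡ e) p
∷ʳ-inner (s ∷ σ) (_ ∷ A) (_ ∷ ps) e = ∷ʳ-inner σ A ps (∷-injectiveʳ e)

framed-inner : ∀ {P : ℕ → Set} σ M A a x c B → All P σ → 0 ∷ σ ++ [ M ] ≡ A ++ a ∷ x ∷ c ∷ B → P x
framed-inner σ M [] a x c B ps e = ∷ʳ-inner σ [] ps (∷-injectiveʳ e)
framed-inner σ M (_ ∷ A) a x c B ps e = ∷ʳ-inner σ (A ++ [ a ]) ps (trans (∷-injectiveʳ e) (sym (++-assoc A [ a ] (x ∷ c ∷ B))))

All-map-interval : ∀ {A : Set} {Q : A → Set} (f : ℕ → A) a k j → All Q (map f (interval a k)) → a ≤ j → j < a + k → Q (f j)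
All-map-interval f a zero j _ p q = ⊥-elim (<⇒≱ q (subst (_≤ j) (sym (+-identityʳ a)) p))
All-map-interval f a (suc k) j (qa ∷ qs) p q with a ≟ j
... | yes refl = qa
... | no a≢j = All-map-interval f (suc a) k j qs (≤∧≢⇒< p a≢j) (subst (j <_) (+-suc a k) q)

occurrences-once : ∀ j xs → OccursOnce j xs → occurrences j xs ≡ 1
occurrences-once j xs (L , R , refl , j∉L , j∉R) =
  trans (countᵇ-++ _ L (j ∷ R))
    (cong₂ _+_ (occurrences-absent j L j∉L) (cong₂ _+_ (cong indicator (≡ᵇ-refl j)) (occurrences-absent j R j∉R)))

-- Letters above n are handled by the symmetry σ = revCompl n σ, which turns them into letters below n.
framed-zigzag : ∀ n σ → Framed n σ → All UpDown (fzSteps σ (oneTo n)) → Zigzag (0 ∷ σ ++ [ suc (2 * n) ])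
framed-zigzag n σ f uds = Zigzag-intro (0 ∷ σ ++ [ M ]) extremum
  where
  open Framed f
  M = suc (2 * n)
  upDown : ∀ j → 1 ≤ j → j ≤ n → UpDown (proj₁ (fzAt σ j))
  upDown j p q = All-map-interval (λ j → proj₁ (fzAt σ j)) 1 n j
                   (subst (λ I → All UpDown (fzSteps σ I)) (oneTo-interval n) uds) p (s≤s q)
  lowExtremum : ∀ {x} → InRange n x → x ≤ n → ∀ A a c B → 0 ∷ σ ++ [ M ] ≡ A ++ a ∷ x ∷ c ∷ B → Extremum a x c
  lowExtremum {x} (1≤x , _) x≤n =
    UpDown⇒Extremum σ M x 1≤x (≤-<-trans x≤n (n<2n+1 n)) (occursOnce x 1≤x x≤n) (upDown x 1≤x x≤n)
  extremum : ∀ A a x c B → 0 ∷ σ ++ [ M ] ≡ A ++ a ∷ x ∷ c ∷ B → Extremum a x c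
  extremum A a x c B e with framed-inner σ M A a x c B inRange e | x ≤? n
  ... | x∈ | yes x≤n = lowExtremum x∈ x≤n A a c B e
  ... | x∈ | no x≰n =
    Extremum-compl⁻ n a x c
      (lowExtremum (compl-InRange n x∈) (≤-pred (compl-high n (≰⇒> x≰n))) (revCompl n B) (compl n c) (compl n a) (revCompl n A)
        (trans (sym (framedWord-symmetric n σ symmetric)) (trans (cong (revCompl n) e) (revCompl-middle n A a x c B))))

zigzag-alternating : ∀ n σ → All (InRange n) σ → Zigzag (0 ∷ σ ++ [ suc (2 * n) ]) → Alternating true (0 ∷ σ ++ [ suc (2 * n) ])
zigzag-alternating n σ inR z =
  subst (λ w → Alternating true (0 ∷ w)) (sym (∷ʳ-uncons M σ))
    (Zigzag⇒Alternating true 0 (head-∷ʳ M σ) (tail-∷ʳ M σ) (subst (λ w → Zigzag (0 ∷ w)) (∷ʳ-uncons M σ) z) (firstRises σ inR))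
  where
  M = suc (2 * n)
  firstRises : ∀ σ → All (InRange n) σ → 0 < head-∷ʳ M σ
  firstRises [] _ = s≤s z≤n
  firstRises (_ ∷ _) ((p , _) ∷ _) = p

framed-halves : ∀ n σ → Framed n σ → length σ ≡ n + n →
  Σ (List ℕ) λ u → (σ ≡ revCompl n u ++ u) × (length u ≡ n) × All (_≤ suc (2 * n)) u
framed-halves n σ f lσ = u , σ≡ , length-u , u≤
  where
  open Framed f
  A = take n σ
  u = drop n σ
  σ≡A++u : σ ≡ A ++ u
  σ≡A++u = sym (take++drop≡id n σ)
  length-A : length A ≡ n
  length-A = trans (length-take n σ) (m≤n⇒m⊓n≡m (subst (n ≤_) (sym lσ) (m≤m+n n n)))
  length-u : length u ≡ n
  length-u = trans (length-drop n σ) (trans (cong (_∸ n) lσ) (m+n∸m≡n n n))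
  A++u≤ : All (_≤ suc (2 * n)) (A ++ u)
  A++u≤ = subst (All _) σ≡A++u (All.map (InRange⇒≤2n+1 n) inRange)
  u≤ = ++⁻ʳ A A++u≤
  revCompl-A≡u : revCompl n A ≡ u
  revCompl-A≡u = ++-cancelˡ-length (revCompl n u) A (revCompl n A) u
    (trans (length-revCompl n u) (trans length-u (sym length-A)))
    (trans (sym (revCompl-++ n A u)) (trans (cong (revCompl n) (sym σ≡A++u)) (trans symmetric σ≡A++u)))
  σ≡ : σ ≡ revCompl n u ++ u
  σ≡ = trans σ≡A++u (cong (_++ u) (trans (sym (revCompl-involutive n A (++⁻ˡ A A++u≤))) (cong (revCompl n) revCompl-A≡u)))

-- Inverting ψ: read u off the second half of σ and undo the tildes.
psi-surjective : ∀ n → 1 ≤ n → ∀ σ → Framed n σ → length σ ≡ n + n → Alternating true (0 ∷ σ ++ [ suc (2 * n) ]) →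
  ∃ λ π → IsSnake n π × psi n π ≡ σ
psi-surjective n 1≤n σ f lσ alt with framed-halves n σ f lσ
... | u , σ≡ , length-u , u≤ = π , (length-π , perm , snakeShape u refl) , psi≡
  where
  open Framed f
  t = complIf (odd n) n u
  π = map (untilde n) t
  t≤ = complIf-≤2n+1 (odd n) n u u≤
  tilde-π : map (tilde n) π ≡ t
  tilde-π = trans (sym (map-∘ t)) (map-id-local (All.universal (tilde-untilde n) t))
  halfOf≡ : halfOf n π ≡ u
  halfOf≡ = trans (cong (complIf (odd n) n) tilde-π) (complIf-involutive (odd n) n u u≤)
  psi≡ : psi n π ≡ σ
  psi≡ = trans (psi-halves n π (subst (All _) (sym tilde-π) t≤)) (trans (cong (λ z → revCompl n z ++ z) halfOf≡) (sym σ≡))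
  length-π : length π ≡ n
  length-π = trans (length-map (untilde n) t) (trans (length-complIf (odd n) n u) length-u)
  once : ∀ k → 1 ≤ k → k ≤ n → occurrences k (map ∣_∣ π) ≡ 1
  once (suc k) _ k<n = begin
    occurrences (suc k) (map ∣_∣ π)                   ≡⟨ occurrences-untilde (odd n) n t k k<n t≤ ⟨
    occurrences (n ∸ k) (revCompl n (complIf (odd n) n t) ++ complIf (odd n) n t)
      ≡⟨ cong (λ z → occurrences (n ∸ k) (revCompl n z ++ z)) (complIf-involutive (odd n) n u u≤) ⟩
    occurrences (n ∸ k) (revCompl n u ++ u)           ≡⟨ cong (occurrences (n ∸ k)) σ≡ ⟨
    occurrences (n ∸ k) σ                             ≡⟨ occurrences-once (n ∸ k) σ (occursOnce (n ∸ k) (m<n⇒0<n∸m k<n) (m∸n≤m n k)) ⟩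
    1                                                 ∎
    where open ≡-Reasoning
  perm : map ∣_∣ π ↭ oneTo n
  perm = subst (map ∣_∣ π ↭_) (sym (oneTo-interval n)) (occurrences⇒↭ n (map ∣_∣ π) (trans (length-map ∣_∣ π) length-π) once)
  snakeShape : ∀ u₀ → u₀ ≡ u → FirstPos (map (untilde n) (complIf (odd n) n u₀)) × AltDown (map (untilde n) (complIf (odd n) n u₀))
  snakeShape [] e = ⊥-elim (<⇒≢ 1≤n (trans (cong length e) length-u))
  snakeShape (u₁ ∷ u′) refl with Alternating-centred⁻ n u₁ u′ length-u centred
    where
    centred : Alternating true (0 ∷ revCompl n (u₁ ∷ u′) ++ u₁ ∷ u′ ++ [ suc (2 * n) ])
    centred = subst (λ w → Alternating true (0 ∷ w)) (trans (cong (_++ [ suc (2 * n) ]) σ≡) (++-assoc (revCompl n u) u _)) alt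
  ... | alt-u , centre = centred⇒snakeShape n u₁ u′ u≤ alt-u centre (odd n) refl

Φ-surjective : ∀ n → 1 ≤ n → (x : List Step × List ℕ) → IsLBP n x → ∃ λ π → IsSnake n π × Φ n π ≡ x
Φ-surjective n 1≤n (P , W) (length-P , lb) =
  proj₁ preimage , proj₁ (proj₂ preimage) ,
  trans (cong (PsiFZhalf n) (proj₂ (proj₂ preimage))) (cong₂ _,_ steps≡ (proj₂ (proj₂ path≡)))
  where
  start = [ 0 ] ∷ []
  admissible-PW = LB⇒AdmissiblePath 1 start 0 P W refl lb
  Fb = insertLows 1 start P W
  lowRuns : LowRuns (suc n) Fb
  lowRuns = subst (λ k → LowRuns (suc k) Fb) length-P
              (insertLows-LowRuns 1 start P W admissible-PW
                 record { nonEmpty = tt ∷ [] ; bounded = (s≤s z≤n ∷ []) ∷ [] ; headZero = tt ; permutation = ↭-refl })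
  open Unframed (unframe n Fb lowRuns)
  open Swept (sweep-framed n σ framed)
  lows≡ : insertLows 1 start (fzSteps σ (oneTo n)) (fzLabels σ (oneTo n)) ≡ Fb
  lows≡ = trans (sym lows-≡)
            (trans (cong lows (segmentation-unique segs (symmetricSegs n Fb) segmentation
                                 (symmetricSegs-segmentation n Fb (LowRuns.nonEmpty lowRuns) (LowRuns.bounded lowRuns))
                                 (trans unsegment-≡ (sym word≡))))
              (lows-symmetricSegs n Fb))
  path≡ = insertLows-injective 1 start start (fzSteps σ (oneTo n)) P (fzLabels σ (oneTo n)) W
            (trans (length-map _ (oneTo n)) (trans (length-oneTo n) (sym length-P)))
            (tt ∷ []) ((s≤s z≤n ∷ []) ∷ []) (tt ∷ []) ((s≤s z≤n ∷ []) ∷ []) admissible admissible-PW lows≡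
  steps≡ : fzSteps σ (oneTo n) ≡ P
  steps≡ = proj₁ (proj₂ path≡)
  alternating = zigzag-alternating n σ (Framed.inRange framed)
                  (framed-zigzag n σ framed (subst (All UpDown) (sym steps≡) (LB⇒UpDown 0 P W lb)))
  preimage = psi-surjective n 1≤n σ framed length-σ alternating

mainTheorem5 : (n : ℕ) → 1 ≤ n →
    -- π ↦ Ψ(ψ(π)) maps 𝒮ₙ into 𝒫ₙ
    ((π : List ℤ) → IsSnake n π → IsLBP n (Φ n π))
    -- injective on 𝒮ₙ
    × ((π π′ : List ℤ) → IsSnake n π → IsSnake n π′ → Φ n π ≡ Φ n π′ → π ≡ π′)
    -- surjective onto 𝒫ₙ
    × ((x : List Step × List ℕ) → IsLBP n x → ∃ λ π → IsSnake n π × Φ n π ≡ x)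
mainTheorem5 n 1≤n = (λ π → Φ-IsLBP n π 1≤n) , Φ-injective n , Φ-surjective n 1≤n
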